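{- Let $\pi\in\mathfrak{B}_n$, write $d=\operatorname{des}^B(\pi)$, $e=\operatorname{ides}^B(\pi)$, and let $n(\pi)$ be the number of negative entries among $\pi_1,\dots,\pi_n$. Among the grid points $(i,j)$, $1\le i,j\le n+1$, of $P_\pi$, the number with $d^+$-type $(0,0)$, $(1,0)$, $(0,1)$, $(1,1)$ is respectively $(d+1)(e+1)-n(\pi)+n$, $(e+1)(n-d)+n(\pi)-n$, $(d+1)(n-e)+n(\pi)-n$, $(n-d)(n-e)-n(\pi)+n$; and the number with $d^-$-type $(0,0)$, $(1,0)$, $(0,1)$, $(1,1)$ is respectively $de+n(\pi)$, $e(n-d+1)-n(\pi)$, $d(n-e+1)-n(\pi)$, $(n-d+1)(n-e+1)+n(\pi)$.
   Context: $\mathfrak{B}_n$ is the set of signed permutations $\pi=\pi_1\cdots\pi_n$ ($\pi_i\in\{\pm1,\dots,\pm n\}$, $|\pi_1|,\dots,|\pi_n|$ a permutation of $[n]$), $\pi_0=0$, inverse given by $\pi^{ -1}_{|\pi_i|}=\operatorname{sgn}(\pi_i)\,i$. Natural order: $\operatorname{des}^B(\pi)=|\{i\in\{0,\dots,n-1\}:\pi_i>\pi_{i+1}\}|$, $\operatorname{ides}^B(\pi)=\operatorname{des}^B(\pi^{ -1})$. Grid points $(i,j)$, $1\le i,j\le n+1$, of the $n\times n$ grid $P_\pi$ are intersections of the $i$-th horizontal (from top) and $j$-th vertical (from left) grid lines. For $i,j\in[n+1]$, $\varphi_{(i,j)}(\pi)$ is the $\sigma\in\mathfrak{B}_{n+1}$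 with $\sigma_i=j$, $\sigma_k=s(\pi_k)$ for $k<i$, $\sigma_k=s(\pi_{k-1})$ for $k>i$, where $s(x)=x$ if $|x|<j$, $s(x)=x+1$ if $x\ge j$, $s(x)=x-1$ if $x\le-j$; $\overline{\varphi}_{(i,j)}(\pi)$ is the same with $\sigma_i=-j$. $d^+(i,j)=\big(\operatorname{des}^B(\varphi_{(i,j)}(\pi))-\operatorname{des}^B(\pi),\ \operatorname{ides}^B(\varphi_{(i,j)}(\pi))-\operatorname{ides}^B(\pi)\big)$, and $d^-(i,j)$ is the same with $\overline{\varphi}_{(i,j)}$. -}

module Defs where

open import Data.Nat as ℕ using (ℕ; zero; suc)
open import Data.Integer as ℤ using (ℤ; +_; -[1+_]; ∣_∣)
open import Data.List using (List; []; _∷_; map; length; filter; take; drop; _++_; upTo; concatMap; sum)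
open import Data.List.Relation.Binary.Permutation.Propositional using (_↭_)
open import Data.Product using (_×_; _,_)
open import Relation.Nullary using (does)
open import Data.Bool using (Bool; true; false; if_then_else_)
open import Relation.Binary.PropositionalEquality using (_≡_)

range1 : ℕ → List ℕ
range1 n = map suc (upTo n)

IsSignedPerm : ℕ → List ℤ → Set
IsSignedPerm n w = map ∣_∣ w ↭ range1 n

descents : List ℤ → ℕ
descents [] = 0
descents (x ∷ []) = 0
descents (x ∷ y ∷ xs) =
  (if does (y ℤ.<? x) then 1 else 0) ℕ.+ descents (y ∷ xs)

desB : List ℤ → ℕ
desB w = descents (+ 0 ∷ w)

-- value π⁻¹_k : sgn(πᵢ)·i for the (1-based) position i with |πᵢ| = k.
-- `invAt k i w` searches w, whose first entry is at position i.
invAt : ℕ → ℕ → List ℤ → ℤ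
invAt k i [] = + 0
invAt k i (x ∷ xs) with does (∣ x ∣ ℕ.≟ k)
... | true  = ℤ.sign x ℤ.◃ i
... | false = invAt k (suc i) xs

inverseB : ℕ → List ℤ → List ℤ
inverseB n w = map (λ k → invAt k 1 w) (range1 n)

idesB : ℕ → List ℤ → ℕ
idesB n w = desB (inverseB n w)

negCount : List ℤ → ℕ
negCount w = length (filter (λ x → x ℤ.<? + 0) w)

shiftB : ℕ → ℤ → ℤ
shiftB j x with does (∣ x ∣ ℕ.<? j) | does (+ 0 ℤ.≤? x)
... | true  | _     = x
... | false | true  = x ℤ.+ + 1
... | false | false = x ℤ.- + 1

insertAt : ℕ → ℤ → List ℤ → List ℤ
insertAt i v w = take (i ℕ.∸ 1) w ++ (v ∷ drop (i ℕ.∸ 1) w)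

φ : ℕ → ℕ → List ℤ → List ℤ
φ i j w = insertAt i (+ j) (map (shiftB j) w)

φ̄ : ℕ → ℕ → List ℤ → List ℤ
φ̄ i j w = insertAt i (ℤ.- (+ j)) (map (shiftB j) w)

dPlus : ℕ → List ℤ → ℕ → ℕ → ℤ × ℤ
dPlus n w i j =
  (+ desB (φ i j w) ℤ.- + desB w , + idesB (suc n) (φ i j w) ℤ.- + idesB n w)

dMinus : ℕ → List ℤ → ℕ → ℕ → ℤ × ℤ
dMinus n w i j =
  (+ desB (φ̄ i j w) ℤ.- + desB w , + idesB (suc n) (φ̄ i j w) ℤ.- + idesB n w)

pairIs : ℤ × ℤ → ℤ → ℤ → Bool
pairIs (x , y) a b = does (x ℤ.≟ a) Data.Bool.∧ does (y ℤ.≟ b)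

gridPoints : ℕ → List (ℕ × ℕ)
gridPoints n = concatMap (λ i → map (λ j → (i , j)) (range1 (suc n))) (range1 (suc n))

countPlus : ℕ → List ℤ → ℤ → ℤ → ℕ
countPlus n w a b =
  length (filter (λ p → pairIs (dPlus n w (Data.Product.proj₁ p) (Data.Product.proj₂ p)) a b Data.Bool.≟ true) (gridPoints n))

countMinus : ℕ → List ℤ → ℤ → ℤ → ℕ
countMinus n w a b =
  length (filter (λ p → pairIs (dMinus n w (Data.Product.proj₁ p) (Data.Product.proj₂ p)) a b Data.Bool.≟ true) (gridPoints n))

module Submission where

-- Write x = 0 π₁ ⋯ πₙ and y = 0 π⁻¹₁ ⋯ π⁻¹ₙ. Inserting a value v right after x_k
-- changes des^B by [v < x_k] + [k < n]([x_{k+1} < v] − [x_{k+1} < x_k]), which is 0 or 1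
-- because "v < a" is upward closed in a. Since φ_(i,j) commutes with inversion up to
-- swapping i and j, the change of ides^B is the same expression read in y. Writing dd, di
-- for the two coordinates of d^±, each type count is a combination of ∑∑ dd, ∑∑ di and
-- ∑∑ dd·di over the (n+1)×(n+1) grid. Summing over k first, ∑∑ dd = (n+1)(r + n − des) and
-- ∑∑ di = (n+1)(r + n − ides), with r = 0 for d⁺ and r = 1 for d⁻. In ∑∑ dd·di the
-- descent terms of π and π⁻¹ split off; the remaining product sum reindexes to a
-- constant grid plus one unit at each (k, l) with π_{k+1} = ±(l+1), which is where n(π)
-- enters: through the positive entries for d⁺ and the negative ones for d⁻.

open import Data.Bool as Bool using (Bool; true; false; not; if_then_else_; T)
open import Data.Empty using (⊥-elim)
open import Data.Integer as ℤ
  using (ℤ; +_; -[1+_]; _+_; _-_; _*_; 0ℤ; 1ℤ; ∣_∣; sign; _◃_; +<+; -<+; -<-; +≤+)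
import Data.Integer.Properties as ℤP
open import Data.Integer.Tactic.RingSolver using (solve-∀)
open import Data.List
  using (List; []; _∷_; map; length; filter; take; drop; _++_; upTo; applyUpTo; concatMap)
import Data.List.Properties as ListP
open import Data.List.Membership.Propositional using (_∈_)
open import Data.List.Membership.Propositional.Properties using (∈-map⁺; ∈-map⁻; ∈-upTo⁻)
open import Data.List.Relation.Binary.Permutation.Propositional using (↭-sym; ↭⇒↭ₛ)
open import Data.List.Relation.Binary.Permutation.Propositional.Properties
  using (∈-resp-↭; ↭-length)
import Data.List.Relation.Binary.Permutation.Setoid.Properties as PermProps
open import Data.List.Relation.Unary.All using (All; _∷_)
open import Data.List.Relation.Unary.Any using (here; there)
open import Data.List.Relation.Unary.AllPairs using (_∷_)
open import Data.List.Relation.Unary.Unique.Propositional using (Unique)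
import Data.List.Relation.Unary.Unique.Propositional.Properties as UniqueP
open import Data.Nat as ℕ using (ℕ; zero; suc; z≤n; s≤s)
import Data.Nat.Properties as ℕP
open import Data.Sign as Sign using (Sign)
open import Data.Product using (_×_; _,_; proj₁; proj₂; ∃)
open import Data.Sum using (_⊎_; inj₁; inj₂)
open import Function.Base using (_∘_)
open import Function.Bundles using (_⇔_; mk⇔; Equivalence)
open import Relation.Binary.Definitions using (tri<; tri≈; tri>)
open import Relation.Binary.PropositionalEquality
open import Relation.Nullary using (yes; no; does; ¬_)
open import Relation.Nullary.Decidable using (dec-true; dec-false; does-⇔)
open import Relation.Nullary.Decidable.Core using (¬?)

open import Defs

𝕀 : Bool → ℤ
𝕀 true = 1ℤ
𝕀 false = 0ℤ

∑ : ℕ → (ℕ → ℤ) → ℤ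
∑ zero f = 0ℤ
∑ (suc n) f = f 0 + ∑ n (λ k → f (suc k))

∑-cong : ∀ n {f g : ℕ → ℤ} → (∀ k → f k ≡ g k) → ∑ n f ≡ ∑ n g
∑-cong zero eq = refl
∑-cong (suc n) eq = cong₂ _+_ (eq 0) (∑-cong n (λ k → eq (suc k)))

∑-cong-< : ∀ n {f g : ℕ → ℤ} → (∀ k → k ℕ.< n → f k ≡ g k) → ∑ n f ≡ ∑ n g
∑-cong-< zero eq = refl
∑-cong-< (suc n) eq =
  cong₂ _+_ (eq 0 (s≤s z≤n)) (∑-cong-< n (λ k k<n → eq (suc k) (s≤s k<n)))

∑-zero : ∀ n → ∑ n (λ _ → 0ℤ) ≡ 0ℤ
∑-zero zero = refl
∑-zero (suc n) = trans (ℤP.+-identityˡ _) (∑-zero n)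

∑-+ : ∀ n (f g : ℕ → ℤ) → ∑ n (λ k → f k + g k) ≡ ∑ n f + ∑ n g
∑-+ zero f g = refl
∑-+ (suc n) f g rewrite ∑-+ n (λ k → f (suc k)) (λ k → g (suc k)) =
  interchange (f 0) (g 0) (∑ n (λ k → f (suc k))) (∑ n (λ k → g (suc k)))
  where
  interchange : ∀ a b c d → a + b + (c + d) ≡ a + c + (b + d)
  interchange = solve-∀

∑-- : ∀ n (f g : ℕ → ℤ) → ∑ n (λ k → f k - g k) ≡ ∑ n f - ∑ n g
∑-- zero f g = refl
∑-- (suc n) f g rewrite ∑-- n (λ k → f (suc k)) (λ k → g (suc k)) =
  interchange (f 0) (g 0) (∑ n (λ k → f (suc k))) (∑ n (λ k → g (suc k)))
  where
  interchange : ∀ a b c d → a - b + (c - d) ≡ a + c - (b + d)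
  interchange = solve-∀

∑-*ˡ : ∀ n c (f : ℕ → ℤ) → ∑ n (λ k → c * f k) ≡ c * ∑ n f
∑-*ˡ zero c f = sym (ℤP.*-zeroʳ c)
∑-*ˡ (suc n) c f rewrite ∑-*ˡ n c (λ k → f (suc k)) =
  sym (ℤP.*-distribˡ-+ c (f 0) (∑ n (λ k → f (suc k))))

∑-*ʳ : ∀ n c (f : ℕ → ℤ) → ∑ n (λ k → f k * c) ≡ ∑ n f * c
∑-*ʳ n c f = trans (∑-cong n (λ k → ℤP.*-comm (f k) c))
                   (trans (∑-*ˡ n c f) (ℤP.*-comm c (∑ n f)))

∑-const : ∀ n c → ∑ n (λ _ → c) ≡ + n * c
∑-const zero c = refl
∑-const (suc n) c rewrite ∑-const n c =
  trans (cong (_+ + n * c) (sym (ℤP.*-identityˡ c))) (sym (ℤP.*-distribʳ-+ c (+ 1) (+ n)))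

∑-1 : ∀ n → ∑ n (λ _ → 1ℤ) ≡ + n
∑-1 n = trans (∑-const n 1ℤ) (ℤP.*-identityʳ (+ n))

∑-swap : ∀ n m (f : ℕ → ℕ → ℤ) → ∑ n (λ k → ∑ m (f k)) ≡ ∑ m (λ l → ∑ n (λ k → f k l))
∑-swap zero m f = sym (∑-zero m)
∑-swap (suc n) m f =
  trans (cong (λ z → ∑ m (f 0) + z) (∑-swap n m (λ k → f (suc k))))
        (sym (∑-+ m (f 0) (λ l → ∑ n (λ k → f (suc k) l))))

∑-dropLast : ∀ n (f : ℕ → ℤ) → ∑ (suc n) (λ k → 𝕀 (k ℕ.<ᵇ n) * f k) ≡ ∑ n f
∑-dropLast zero f = ℤP.+-identityʳ _
∑-dropLast (suc n) f = cong₂ _+_ (ℤP.*-identityˡ (f 0)) (∑-dropLast n (λ k → f (suc k)))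

∑∑ : ℕ → (ℕ → ℕ → ℤ) → ℤ
∑∑ n f = ∑ n (λ k → ∑ n (f k))

∑∑-cong : ∀ n {f g : ℕ → ℕ → ℤ} → (∀ k l → f k l ≡ g k l) → ∑∑ n f ≡ ∑∑ n g
∑∑-cong n eq = ∑-cong n (λ k → ∑-cong n (eq k))

∑∑-+ : ∀ n f g → ∑∑ n (λ k l → f k l + g k l) ≡ ∑∑ n f + ∑∑ n g
∑∑-+ n f g = trans (∑-cong n (λ k → ∑-+ n (f k) (g k))) (∑-+ n (λ k → ∑ n (f k)) (λ k → ∑ n (g k)))

∑∑-- : ∀ n f g → ∑∑ n (λ k l → f k l - g k l) ≡ ∑∑ n f - ∑∑ n g
∑∑-- n f g = trans (∑-cong n (λ k → ∑-- n (f k) (g k))) (∑-- n (λ k → ∑ n (f k)) (λ k → ∑ n (g k)))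

∑∑-1 : ∀ n → ∑∑ n (λ _ _ → 1ℤ) ≡ + n * + n
∑∑-1 n = trans (∑-cong n (λ _ → ∑-1 n)) (∑-const n (+ n))

data ShiftView (j : ℕ) (x : ℤ) : ℤ → Set where
  small  : ∣ x ∣ ℕ.< j → ShiftView j x x
  posBig : ∀ m → x ≡ + m → j ℕ.≤ m → ShiftView j x (+ suc m)
  negBig : ∀ m → x ≡ -[1+ m ] → j ℕ.≤ suc m → ShiftView j x -[1+ suc m ]

shiftView : ∀ j x → ShiftView j x (shiftB j x)
shiftView j x with ∣ x ∣ ℕ.<ᵇ j in e | + 0 ℤ.≤? x
... | true | _ = small (ℕP.<ᵇ⇒< ∣ x ∣ j (subst T (sym e) _))
shiftView j (+ m) | false | yes _ =
  subst (ShiftView j (+ m)) (cong +_ (ℕP.+-comm 1 m))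
        (posBig m refl (ℕP.≮⇒≥ (λ lt → subst T e (ℕP.<⇒<ᵇ lt))))
shiftView j (+ m) | false | no 0≰m = ⊥-elim (0≰m (+≤+ z≤n))
shiftView j -[1+ m ] | false | no _ =
  subst (ShiftView j -[1+ m ]) (cong (λ z → -[1+ suc z ]) (sym (ℕP.+-identityʳ m)))
        (negBig m refl (ℕP.≮⇒≥ (λ lt → subst T e (ℕP.<⇒<ᵇ lt))))

shiftB-small : ∀ {j} x → ∣ x ∣ ℕ.< j → shiftB j x ≡ x
shiftB-small {j} x lt with shiftB j x | shiftView j x
... | _ | small _ = refl
... | _ | posBig m refl j≤m = ⊥-elim (ℕP.<⇒≱ lt j≤m)
... | _ | negBig m refl j≤m = ⊥-elim (ℕP.<⇒≱ lt j≤m)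

∣shiftB∣-big : ∀ {j} x → ¬ (∣ x ∣ ℕ.< j) → ∣ shiftB j x ∣ ≡ suc ∣ x ∣
∣shiftB∣-big {j} x ≮ with shiftB j x | shiftView j x
... | _ | small lt = ⊥-elim (≮ lt)
... | _ | posBig m refl _ = refl
... | _ | negBig m refl _ = refl

sign-shiftB : ∀ {j} x → sign (shiftB j x) ≡ sign x
sign-shiftB {j} x with shiftB j x | shiftView j x
... | _ | small _ = refl
... | _ | posBig m refl _ = refl
... | _ | negBig m refl _ = refl

∣shiftB∣≢ : ∀ {j} x → ∣ shiftB j x ∣ ≢ j
∣shiftB∣≢ {j} x with shiftB j x | shiftView j x
... | _ | small lt = λ eq → ℕP.<-irrefl eq lt
... | _ | posBig m refl j≤m = λ eq → ℕP.<-irrefl (sym eq) (s≤s j≤m)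
... | _ | negBig m refl j≤m = λ eq → ℕP.<-irrefl (sym eq) (s≤s j≤m)

shiftB-mono-< : ∀ {j} x y → x ℤ.< y → shiftB j x ℤ.< shiftB j y
shiftB-mono-< {j} x y x<y with shiftB j x | shiftView j x | shiftB j y | shiftView j y
... | _ | small _ | _ | small _ = x<y
... | _ | small _ | _ | posBig m refl _ = ℤP.<-trans x<y (+<+ (ℕP.n<1+n m))
... | _ | small ∣x∣<j | _ | negBig m refl j≤ =
  ⊥-elim (ℕP.<⇒≱ ∣x∣<j (ℕP.≤-trans j≤ (ℕP.<⇒≤ (below x<y))))
  where
  below : ∀ {x m} → x ℤ.< -[1+ m ] → suc m ℕ.< ∣ x ∣
  below (-<- lt) = s≤s lt
... | _ | posBig m refl j≤ | _ | small ∣y∣<j =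
  ⊥-elim (ℕP.<⇒≱ ∣y∣<j (ℕP.≤-trans j≤ (ℕP.<⇒≤ (above x<y))))
  where
  above : ∀ {y m} → + m ℤ.< y → m ℕ.< ∣ y ∣
  above (+<+ lt) = lt
... | _ | posBig m refl _ | _ | posBig m' refl _ with x<y
...   | +<+ lt = +<+ (s≤s lt)
shiftB-mono-< x y () | _ | posBig m refl _ | _ | negBig m' refl _
shiftB-mono-< x y x<y | _ | negBig m refl _ | _ | small _ = ℤP.<-trans (-<- (ℕP.n<1+n m)) x<y
shiftB-mono-< x y x<y | _ | negBig m refl _ | _ | posBig m' refl _ = -<+
shiftB-mono-< x y (-<- lt) | _ | negBig m refl _ | _ | negBig m' refl _ = -<- (s≤s lt)

shiftB-<-iff : ∀ j x y → does (shiftB j y ℤ.<? shiftB j x) ≡ does (y ℤ.<? x)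
shiftB-<-iff j x y = does-⇔ (mk⇔ reflect (shiftB-mono-< {j} y x)) (shiftB j y ℤ.<? shiftB j x) (y ℤ.<? x)
  where
  reflect : shiftB j y ℤ.< shiftB j x → y ℤ.< x
  reflect lt with y ℤ.<? x | x ℤ.≟ y
  ... | yes y<x | _ = y<x
  ... | no _ | yes refl = ⊥-elim (ℤP.<-irrefl refl lt)
  ... | no y≮x | no x≢y = ⊥-elim (ℤP.<-asym lt (shiftB-mono-< {j} x y (ℤP.≤∧≢⇒< (ℤP.≮⇒≥ y≮x) x≢y)))

+j<shiftB-iff : ∀ j a → does (+ j ℤ.<? shiftB j a) ≡ does (+ j ℤ.≤? a)
+j<shiftB-iff j a = does-⇔ (mk⇔ to from) (+ j ℤ.<? shiftB j a) (+ j ℤ.≤? a)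
  where
  to : + j ℤ.< shiftB j a → + j ℤ.≤ a
  to lt with shiftB j a | shiftView j a
  to (+<+ j<m) | _ | small ∣a∣<j = ⊥-elim (ℕP.<-asym j<m ∣a∣<j)
  ... | _ | posBig m refl j≤m = +≤+ j≤m
  to () | _ | negBig m refl _
  from : + j ℤ.≤ a → + j ℤ.< shiftB j a
  from le with shiftB j a | shiftView j a
  from (+≤+ j≤m) | _ | small ∣a∣<j = ⊥-elim (ℕP.<⇒≱ ∣a∣<j j≤m)
  ... | _ | posBig m refl j≤m = +<+ (s≤s j≤m)
  from () | _ | negBig m refl _

-j<shiftB-iff : ∀ j a → does (-[1+ j ] ℤ.<? shiftB (suc j) a) ≡ does (-[1+ j ] ℤ.<? a)
-j<shiftB-iff j a = does-⇔ (mk⇔ to from) (-[1+ j ] ℤ.<? shiftB (suc j) a) (-[1+ j ] ℤ.<? a)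
  where
  to : -[1+ j ] ℤ.< shiftB (suc j) a → -[1+ j ] ℤ.< a
  to lt with shiftB (suc j) a | shiftView (suc j) a
  ... | _ | small _ = lt
  ... | _ | posBig m refl _ = -<+
  to (-<- m<j) | _ | negBig m refl (s≤s j≤m) = ⊥-elim (ℕP.<⇒≱ m<j (ℕP.≤-trans j≤m (ℕP.n≤1+n m)))
  from : -[1+ j ] ℤ.< a → -[1+ j ] ℤ.< shiftB (suc j) a
  from lt with shiftB (suc j) a | shiftView (suc j) a
  ... | _ | small _ = lt
  ... | _ | posBig m refl _ = -<+
  from (-<- m<j) | _ | negBig m refl (s≤s j≤m) = ⊥-elim (ℕP.<⇒≱ m<j j≤m)

shiftB-<-flip : ∀ j b v → ∣ v ∣ ≡ j → does (shiftB j b ℤ.<? v) ≡ not (does (v ℤ.<? shiftB j b))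
shiftB-<-flip j b v ∣v∣≡j =
  does-⇔ (mk⇔ (λ b<v v<b → ℤP.<-asym b<v v<b) (λ v≮b → ℤP.≤∧≢⇒< (ℤP.≮⇒≥ v≮b) b≢v))
         (shiftB j b ℤ.<? v) (¬? (v ℤ.<? shiftB j b))
  where
  b≢v : shiftB j b ≢ v
  b≢v eq = ∣shiftB∣≢ {j} b (trans (cong ∣_∣ eq) ∣v∣≡j)

entry : List ℤ → ℕ → ℤ
entry [] k = + 0
entry (a ∷ l) zero = a
entry (a ∷ l) (suc k) = entry l k

entry-map : ∀ (f : ℤ → ℤ) → f (+ 0) ≡ + 0 → ∀ l k → entry (map f l) k ≡ f (entry l k)
entry-map f f0 [] k = sym f0
entry-map f f0 (a ∷ l) zero = refl
entry-map f f0 (a ∷ l) (suc k) = entry-map f f0 l k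

⟦_<_⟧ : ℤ → ℤ → ℤ
⟦ x < y ⟧ = 𝕀 (does (x ℤ.<? y))

descents-∷∷ : ∀ a b l → + descents (a ∷ b ∷ l) ≡ ⟦ b < a ⟧ + + descents (b ∷ l)
descents-∷∷ a b l with does (b ℤ.<? a)
... | true = ℤP.pos-+ 1 (descents (b ∷ l))
... | false = ℤP.pos-+ 0 (descents (b ∷ l))

descents-as-∑ : ∀ a l →
  + descents (a ∷ l) ≡ ∑ (length l) (λ i → ⟦ entry (a ∷ l) (suc i) < entry (a ∷ l) i ⟧)
descents-as-∑ a [] = refl
descents-as-∑ a (b ∷ l) = trans (descents-∷∷ a b l) (cong (_+_ ⟦ b < a ⟧) (descents-as-∑ b l))

descents-map : ∀ (f : ℤ → ℤ) → (∀ x y → does (f y ℤ.<? f x) ≡ does (y ℤ.<? x)) →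
  ∀ l → descents (map f l) ≡ descents l
descents-map f f-iff [] = refl
descents-map f f-iff (a ∷ []) = refl
descents-map f f-iff (a ∷ b ∷ l) =
  cong₂ ℕ._+_ (cong (λ c → if c then 1 else 0) (f-iff a b)) (descents-map f f-iff (b ∷ l))

-- Inserting v after the entry a_q of a₀ a₁ ⋯ creates the pair (a_q, v) and, unless
-- v is appended at the end, replaces the pair (a_q, a_{q+1}) by (v, a_{q+1}).
descents-insert : ∀ q a l v → q ℕ.≤ length l →
  + descents (take (suc q) (a ∷ l) ++ v ∷ drop (suc q) (a ∷ l))
  ≡ + descents (a ∷ l) + ⟦ v < entry (a ∷ l) q ⟧
    + 𝕀 (q ℕ.<ᵇ length l) * (⟦ entry (a ∷ l) (suc q) < v ⟧ - ⟦ entry (a ∷ l) (suc q) < entry (a ∷ l) q ⟧)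
descents-insert zero a [] v _ = trans (descents-∷∷ a v []) (ring ⟦ v < a ⟧)
  where
  ring : ∀ x → x + + 0 ≡ + 0 + x + 0ℤ * (0ℤ - 0ℤ)
  ring = solve-∀
descents-insert zero a (b ∷ l) v _ = begin
  + descents (a ∷ v ∷ b ∷ l)                 ≡⟨ descents-∷∷ a v (b ∷ l) ⟩
  ⟦ v < a ⟧ + + descents (v ∷ b ∷ l)          ≡⟨ cong (_+_ ⟦ v < a ⟧) (descents-∷∷ v b l) ⟩
  ⟦ v < a ⟧ + (⟦ b < v ⟧ + + descents (b ∷ l)) ≡⟨ ring ⟦ v < a ⟧ ⟦ b < v ⟧ ⟦ b < a ⟧ (+ descents (b ∷ l)) ⟩
  ⟦ b < a ⟧ + + descents (b ∷ l) + ⟦ v < a ⟧ + 1ℤ * (⟦ b < v ⟧ - ⟦ b < a ⟧)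
    ≡⟨ cong (λ z → z + ⟦ v < a ⟧ + 1ℤ * (⟦ b < v ⟧ - ⟦ b < a ⟧)) (sym (descents-∷∷ a b l)) ⟩
  + descents (a ∷ b ∷ l) + ⟦ v < a ⟧ + 1ℤ * (⟦ b < v ⟧ - ⟦ b < a ⟧) ∎
  where
  open ≡-Reasoning
  ring : ∀ x y z d → x + (y + d) ≡ z + d + x + 1ℤ * (y - z)
  ring = solve-∀
descents-insert (suc q) a (b ∷ l) v (s≤s q≤l) = begin
  + descents (a ∷ take (suc q) (b ∷ l) ++ v ∷ drop (suc q) (b ∷ l))
    ≡⟨ descents-∷∷ a b (take q l ++ v ∷ drop q l) ⟩
  ⟦ b < a ⟧ + + descents (take (suc q) (b ∷ l) ++ v ∷ drop (suc q) (b ∷ l))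
    ≡⟨ cong (_+_ ⟦ b < a ⟧) (descents-insert q b l v q≤l) ⟩
  ⟦ b < a ⟧ + (+ descents (b ∷ l) + Δ₁ + Δ₂)
    ≡⟨ ring ⟦ b < a ⟧ (+ descents (b ∷ l)) Δ₁ Δ₂ ⟩
  ⟦ b < a ⟧ + + descents (b ∷ l) + Δ₁ + Δ₂
    ≡⟨ cong (λ z → z + Δ₁ + Δ₂) (sym (descents-∷∷ a b l)) ⟩
  + descents (a ∷ b ∷ l) + Δ₁ + Δ₂ ∎
  where
  open ≡-Reasoning
  Δ₁ Δ₂ : ℤ
  Δ₁ = ⟦ v < entry (b ∷ l) q ⟧
  Δ₂ = 𝕀 (q ℕ.<ᵇ length l) * (⟦ entry (b ∷ l) (suc q) < v ⟧ - ⟦ entry (b ∷ l) (suc q) < entry (b ∷ l) q ⟧)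
  ring : ∀ x d y z → x + (d + y + z) ≡ x + d + y + z
  ring = solve-∀

∑L : {A : Set} → List A → (A → ℤ) → ℤ
∑L [] f = 0ℤ
∑L (x ∷ xs) f = f x + ∑L xs f

∑L-++ : {A : Set} (xs ys : List A) (f : A → ℤ) → ∑L (xs ++ ys) f ≡ ∑L xs f + ∑L ys f
∑L-++ [] ys f = sym (ℤP.+-identityˡ _)
∑L-++ (x ∷ xs) ys f rewrite ∑L-++ xs ys f = sym (ℤP.+-assoc (f x) _ _)

∑L-concatMap : {A C : Set} (g : A → List C) (xs : List A) (f : C → ℤ) →
  ∑L (concatMap g xs) f ≡ ∑L xs (λ x → ∑L (g x) f)
∑L-concatMap g [] f = refl
∑L-concatMap g (x ∷ xs) f =
  trans (∑L-++ (g x) (concatMap g xs) f) (cong (_+_ (∑L (g x) f)) (∑L-concatMap g xs f))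

∑L-map : {A C : Set} (g : A → C) (xs : List A) (f : C → ℤ) → ∑L (map g xs) f ≡ ∑L xs (λ x → f (g x))
∑L-map g [] f = refl
∑L-map g (x ∷ xs) f = cong (_+_ (f (g x))) (∑L-map g xs f)

∑L-applyUpTo : {A : Set} (g : ℕ → A) (m : ℕ) (f : A → ℤ) → ∑L (applyUpTo g m) f ≡ ∑ m (λ k → f (g k))
∑L-applyUpTo g zero f = refl
∑L-applyUpTo g (suc m) f = cong (_+_ (f (g 0))) (∑L-applyUpTo (λ k → g (suc k)) m f)

∑L-range1 : ∀ m (f : ℕ → ℤ) → ∑L (range1 m) f ≡ ∑ m (λ k → f (suc k))
∑L-range1 m f = trans (∑L-map suc (upTo m) f) (∑L-applyUpTo (λ k → k) m (λ k → f (suc k)))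

length-filter : {A : Set} (Q : A → Bool) (xs : List A) →
  + length (filter (λ x → Q x Bool.≟ true) xs) ≡ ∑L xs (λ x → 𝕀 (Q x))
length-filter Q [] = refl
length-filter Q (x ∷ xs) with Q x
... | true = trans (ℤP.pos-+ 1 _) (cong (_+_ 1ℤ) (length-filter Q xs))
... | false = trans (length-filter Q xs) (sym (ℤP.+-identityˡ _))

count-gridPoints : ∀ n (Q : ℕ × ℕ → Bool) →
  + length (filter (λ p → Q p Bool.≟ true) (gridPoints n))
  ≡ ∑∑ (suc n) (λ k l → 𝕀 (Q (suc k , suc l)))
count-gridPoints n Q = begin
  + length (filter (λ p → Q p Bool.≟ true) (gridPoints n))
    ≡⟨ length-filter Q (gridPoints n) ⟩
  ∑L (gridPoints n) (λ p → 𝕀 (Q p))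
    ≡⟨ ∑L-concatMap row (range1 (suc n)) (λ p → 𝕀 (Q p)) ⟩
  ∑L (range1 (suc n)) (λ i → ∑L (row i) (λ p → 𝕀 (Q p)))
    ≡⟨ ∑L-range1 (suc n) (λ i → ∑L (row i) (λ p → 𝕀 (Q p))) ⟩
  ∑ (suc n) (λ k → ∑L (row (suc k)) (λ p → 𝕀 (Q p)))
    ≡⟨ ∑-cong (suc n) (λ k → trans (∑L-map (suc k ,_) (range1 (suc n)) (λ p → 𝕀 (Q p)))
                                     (∑L-range1 (suc n) (λ j → 𝕀 (Q (suc k , j))))) ⟩
  ∑∑ (suc n) (λ k l → 𝕀 (Q (suc k , suc l))) ∎
  where
  open ≡-Reasoning
  row : ℕ → List (ℕ × ℕ)
  row i = map (i ,_) (range1 (suc n))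

invAt-hit : ∀ K s x w → ∣ x ∣ ≡ K → invAt K s (x ∷ w) ≡ sign x ◃ s
invAt-hit K s x w eq rewrite dec-true (∣ x ∣ ℕ.≟ K) eq = refl

invAt-miss : ∀ K s x w → ∣ x ∣ ≢ K → invAt K s (x ∷ w) ≡ invAt K (suc s) w
invAt-miss K s x w ne rewrite dec-false (∣ x ∣ ℕ.≟ K) ne = refl

invAt-map : ∀ (f : ℤ → ℤ) K K' →
  (∀ x → ∣ f x ∣ ≡ K → ∣ x ∣ ≡ K') → (∀ x → ∣ x ∣ ≡ K' → ∣ f x ∣ ≡ K) → (∀ x → sign (f x) ≡ sign x) → ∀ s w → invAt K s (map f w) ≡ invAt K' s w
invAt-map f K K' to from sign-f s [] = refl
invAt-map f K K' to from sign-f s (x ∷ w) with ∣ x ∣ ℕ.≟ K'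
... | yes eq = trans (invAt-hit K s (f x) (map f w) (from x eq))
               (trans (cong (_◃ s) (sign-f x)) (sym (invAt-hit K' s x w eq)))
... | no ne = trans (invAt-miss K s (f x) (map f w) (λ eq → ne (to x eq)))
             (trans (invAt-map f K K' to from sign-f (suc s) w) (sym (invAt-miss K' s x w ne)))

-- Starting the position count one later shifts every reported position ≥ t by one.
invAt-suc : ∀ K t s w → 1 ℕ.≤ t → t ℕ.≤ s → invAt K (suc s) w ≡ shiftB t (invAt K s w)
invAt-suc K t s [] 1≤t _ = sym (shiftB-small {t} (+ 0) 1≤t)
invAt-suc K (suc t) zero (x ∷ w) _ ()
invAt-suc K t (suc s) (x ∷ w) 1≤t t≤s with ∣ x ∣ ℕ.≟ K
... | yes eq = trans (invAt-hit K (suc (suc s)) x w eq)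
               (trans (ℤP.◃-cong same-sign same-abs) (cong (shiftB t) (sym (invAt-hit K (suc s) x w eq))))
  where
  same-sign : sign (sign x ◃ suc (suc s)) ≡ sign (shiftB t (sign x ◃ suc s))
  same-sign = trans (ℤP.sign-◃ (sign x) (suc (suc s)))
                    (sym (trans (sign-shiftB {t} (sign x ◃ suc s)) (ℤP.sign-◃ (sign x) (suc s))))
  same-abs : ∣ sign x ◃ suc (suc s) ∣ ≡ ∣ shiftB t (sign x ◃ suc s) ∣
  same-abs = trans (ℤP.abs-◃ (sign x) (suc (suc s)))
    (sym (trans (∣shiftB∣-big {t} (sign x ◃ suc s)
                   (λ lt → ℕP.<⇒≱ (subst (ℕ._< t) (ℤP.abs-◃ (sign x) (suc s)) lt) t≤s))
                (cong suc (ℤP.abs-◃ (sign x) (suc s)))))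
... | no ne = trans (invAt-miss K (suc (suc s)) x w ne)
             (trans (invAt-suc K t (suc (suc s)) w 1≤t (ℕP.m≤n⇒m≤1+n t≤s))
                    (cong (shiftB t) (sym (invAt-miss K (suc s) x w ne))))

invAt-insert-other : ∀ K s q (l : List ℤ) v → ∣ v ∣ ≢ K → 1 ℕ.≤ s → q ℕ.≤ length l →
  invAt K s (take q l ++ v ∷ drop q l) ≡ shiftB (s ℕ.+ q) (invAt K s l)
invAt-insert-other K s zero l v ne 1≤s _ =
  trans (invAt-miss K s v l ne)
        (trans (invAt-suc K s s l 1≤s ℕP.≤-refl) (cong (λ t → shiftB t (invAt K s l)) (sym (ℕP.+-identityʳ s))))
invAt-insert-other K s (suc q) (a ∷ l) v ne 1≤s (s≤s q≤l) with ∣ a ∣ ℕ.≟ K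
... | yes eq = trans (invAt-hit K s a _ eq)
    (trans (sym (shiftB-small {s ℕ.+ suc q} (sign a ◃ s)
                  (subst (ℕ._< s ℕ.+ suc q) (sym (ℤP.abs-◃ (sign a) s)) (ℕP.m<m+n s (s≤s z≤n)))))
           (cong (shiftB (s ℕ.+ suc q)) (sym (invAt-hit K s a l eq))))
... | no ∣a∣≢K = trans (invAt-miss K s a _ ∣a∣≢K)
    (trans (invAt-insert-other K (suc s) q l v ne (s≤s z≤n) q≤l)
    (trans (cong (λ t → shiftB t (invAt K (suc s) l)) (sym (ℕP.+-suc s q)))
           (cong (shiftB (s ℕ.+ suc q)) (sym (invAt-miss K s a l ∣a∣≢K)))))

invAt-insert-self : ∀ K s q (f : ℤ → ℤ) (w : List ℤ) v →
  (∀ x → ∣ f x ∣ ≢ K) → ∣ v ∣ ≡ K → q ℕ.≤ length w →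
  invAt K s (take q (map f w) ++ v ∷ drop q (map f w)) ≡ sign v ◃ (s ℕ.+ q)
invAt-insert-self K s zero f w v f≢ eq _ =
  trans (invAt-hit K s v _ eq) (cong (sign v ◃_) (sym (ℕP.+-identityʳ s)))
invAt-insert-self K s (suc q) f (x ∷ w) v f≢ eq (s≤s q≤w) =
  trans (invAt-miss K s (f x) _ (f≢ x))
        (trans (invAt-insert-self K (suc s) q f w v f≢ eq q≤w) (cong (sign v ◃_) (sym (ℕP.+-suc s q))))

length-insert : ∀ q (l : List ℤ) v → q ℕ.≤ length l → length (take q l ++ v ∷ drop q l) ≡ suc (length l)
length-insert zero l v _ = refl
length-insert (suc q) (a ∷ l) v (s≤s q≤l) = cong suc (length-insert q l v q≤l)

entry-insert-< : ∀ m q (l : List ℤ) v → m ℕ.< q → q ℕ.≤ length l →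
  entry (take q l ++ v ∷ drop q l) m ≡ entry l m
entry-insert-< zero (suc q) (a ∷ l) v _ _ = refl
entry-insert-< (suc m) (suc q) (a ∷ l) v (s≤s m<q) (s≤s q≤l) = entry-insert-< m q l v m<q q≤l

entry-insert-≡ : ∀ q (l : List ℤ) v → q ℕ.≤ length l → entry (take q l ++ v ∷ drop q l) q ≡ v
entry-insert-≡ zero l v _ = refl
entry-insert-≡ (suc q) (a ∷ l) v (s≤s q≤l) = entry-insert-≡ q l v q≤l

entry-insert-> : ∀ m q (l : List ℤ) v → q ℕ.≤ m → q ℕ.≤ length l →
  entry (take q l ++ v ∷ drop q l) (suc m) ≡ entry l m
entry-insert-> m zero l v _ _ = refl
entry-insert-> (suc m) (suc q) (a ∷ l) v (s≤s q≤m) (s≤s q≤l) = entry-insert-> m q l v q≤m q≤l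

entry-ext : ∀ (l₁ l₂ : List ℤ) → length l₁ ≡ length l₂ →
  (∀ m → m ℕ.< length l₁ → entry l₁ m ≡ entry l₂ m) → l₁ ≡ l₂
entry-ext [] [] _ _ = refl
entry-ext (a ∷ l₁) (b ∷ l₂) eq pointwise =
  cong₂ _∷_ (pointwise 0 (s≤s z≤n))
            (entry-ext l₁ l₂ (ℕP.suc-injective eq) (λ m lt → pointwise (suc m) (s≤s lt)))

length-range1 : ∀ n → length (range1 n) ≡ n
length-range1 n = trans (ListP.length-map suc (upTo n)) (ListP.length-upTo n)

length-inverseB : ∀ n w → length (inverseB n w) ≡ n
length-inverseB n w = trans (ListP.length-map (λ k → invAt k 1 w) (range1 n)) (length-range1 n)

entry-inverseB : ∀ n w m → m ℕ.< n → entry (inverseB n w) m ≡ invAt (suc m) 1 w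
entry-inverseB n w m = go (λ k → k) n m
  where
  go : ∀ (g : ℕ → ℕ) N m → m ℕ.< N →
    entry (map (λ k → invAt k 1 w) (map suc (applyUpTo g N))) m ≡ invAt (suc (g m)) 1 w
  go g (suc N) zero _ = refl
  go g (suc N) (suc m) (s≤s m<N) = go (λ k → g (suc k)) N m m<N

∣shiftB∣≡-below : ∀ j K x → K ℕ.< j → ∣ shiftB j x ∣ ≡ K → ∣ x ∣ ≡ K
∣shiftB∣≡-below j K x K<j eq with shiftB j x | shiftView j x
... | _ | small _ = eq
... | _ | posBig m refl j≤m = ⊥-elim (ℕP.<⇒≱ K<j (ℕP.≤-trans j≤m (subst (m ℕ.≤_) eq (ℕP.n≤1+n m))))
... | _ | negBig m refl j≤m = ⊥-elim (ℕP.<⇒≱ K<j (ℕP.≤-trans j≤m (subst (suc m ℕ.≤_) eq (ℕP.n≤1+n (suc m)))))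

∣shiftB∣≡-below⁻ : ∀ j K x → K ℕ.< j → ∣ x ∣ ≡ K → ∣ shiftB j x ∣ ≡ K
∣shiftB∣≡-below⁻ j K x K<j eq = trans (cong ∣_∣ (shiftB-small {j} x (subst (ℕ._< j) (sym eq) K<j))) eq

∣shiftB∣≡-above : ∀ j K x → j ℕ.≤ K → ∣ shiftB j x ∣ ≡ suc K → ∣ x ∣ ≡ K
∣shiftB∣≡-above j K x j≤K eq with shiftB j x | shiftView j x
... | _ | small ∣x∣<j = ⊥-elim (ℕP.<⇒≱ ∣x∣<j (ℕP.≤-trans j≤K (subst (K ℕ.≤_) (sym eq) (ℕP.n≤1+n K))))
... | _ | posBig m refl _ = ℕP.suc-injective eq
... | _ | negBig m refl _ = ℕP.suc-injective eq

∣shiftB∣≡-above⁻ : ∀ j K x → j ℕ.≤ K → ∣ x ∣ ≡ K → ∣ shiftB j x ∣ ≡ suc K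
∣shiftB∣≡-above⁻ j K x j≤K eq with shiftB j x | shiftView j x
... | _ | small ∣x∣<j = ⊥-elim (ℕP.<⇒≱ ∣x∣<j (subst (j ℕ.≤_) (sym eq) j≤K))
... | _ | posBig m refl _ = cong suc eq
... | _ | negBig m refl _ = cong suc eq

inverseB-insert : ∀ n (w : List ℤ) k l v → length w ≡ n → k ℕ.≤ n → l ℕ.≤ n → ∣ v ∣ ≡ suc l →
  inverseB (suc n) (insertAt (suc k) v (map (shiftB (suc l)) w))
  ≡ insertAt (suc l) (sign v ◃ suc k) (map (shiftB (suc k)) (inverseB n w))
inverseB-insert n w k l v ∣w∣≡n k≤n l≤n ∣v∣≡ = entry-ext _ _ same-length same-entries
  where
  σ = insertAt (suc k) v (map (shiftB (suc l)) w)
  shifted⁻¹ = map (shiftB (suc k)) (inverseB n w)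
  v' = sign v ◃ suc k
  ∣shifted⁻¹∣≡n : length shifted⁻¹ ≡ n
  ∣shifted⁻¹∣≡n = trans (ListP.length-map (shiftB (suc k)) (inverseB n w)) (length-inverseB n w)
  k≤∣w∣ : k ℕ.≤ length (map (shiftB (suc l)) w)
  k≤∣w∣ = subst (k ℕ.≤_) (sym (trans (ListP.length-map (shiftB (suc l)) w) ∣w∣≡n)) k≤n
  l≤∣w⁻¹∣ : l ℕ.≤ length shifted⁻¹
  l≤∣w⁻¹∣ = subst (l ℕ.≤_) (sym ∣shifted⁻¹∣≡n) l≤n
  same-length : length (inverseB (suc n) σ) ≡ length (insertAt (suc l) v' shifted⁻¹)
  same-length = trans (length-inverseB (suc n) σ)
                      (sym (trans (length-insert l shifted⁻¹ v' l≤∣w⁻¹∣) (cong suc ∣shifted⁻¹∣≡n)))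
  entry-shifted⁻¹ : ∀ m → m ℕ.< n → entry shifted⁻¹ m ≡ shiftB (suc k) (invAt (suc m) 1 w)
  entry-shifted⁻¹ m m<n = trans (entry-map (shiftB (suc k)) refl (inverseB n w) m)
                                (cong (shiftB (suc k)) (entry-inverseB n w m m<n))
  same-entries : ∀ m → m ℕ.< length (inverseB (suc n) σ) →
    entry (inverseB (suc n) σ) m ≡ entry (insertAt (suc l) v' shifted⁻¹) m
  same-entries m m<∣σ∣ with ℕP.<-cmp m l | subst (m ℕ.<_) (length-inverseB (suc n) σ) m<∣σ∣
  ... | tri< m<l _ _ | m<1+n = begin
    entry (inverseB (suc n) σ) m       ≡⟨ entry-inverseB (suc n) σ m m<1+n ⟩
    invAt (suc m) 1 σ
      ≡⟨ invAt-insert-other (suc m) 1 k _ v (λ eq → ℕP.<-irrefl (trans (sym eq) ∣v∣≡) (s≤s m<l))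
                            (s≤s z≤n) k≤∣w∣ ⟩
    shiftB (suc k) (invAt (suc m) 1 (map (shiftB (suc l)) w))
      ≡⟨ cong (shiftB (suc k)) (invAt-map (shiftB (suc l)) (suc m) (suc m)
                 (λ x → ∣shiftB∣≡-below (suc l) (suc m) x (s≤s m<l))
                 (λ x → ∣shiftB∣≡-below⁻ (suc l) (suc m) x (s≤s m<l)) (sign-shiftB {suc l}) 1 w) ⟩
    shiftB (suc k) (invAt (suc m) 1 w) ≡⟨ sym (entry-shifted⁻¹ m (ℕP.<-≤-trans m<l l≤n)) ⟩
    entry shifted⁻¹ m                   ≡⟨ sym (entry-insert-< m l shifted⁻¹ v' m<l l≤∣w⁻¹∣) ⟩
    entry (insertAt (suc l) v' shifted⁻¹) m ∎
    where open ≡-Reasoning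
  ... | tri≈ _ refl _ | m<1+n = begin
    entry (inverseB (suc n) σ) m ≡⟨ entry-inverseB (suc n) σ m m<1+n ⟩
    invAt (suc m) 1 σ
      ≡⟨ invAt-insert-self (suc m) 1 k (shiftB (suc m)) w v (∣shiftB∣≢ {suc m}) ∣v∣≡
                           (subst (k ℕ.≤_) (sym ∣w∣≡n) k≤n) ⟩
    v'                           ≡⟨ sym (entry-insert-≡ m shifted⁻¹ v' l≤∣w⁻¹∣) ⟩
    entry (insertAt (suc l) v' shifted⁻¹) m ∎
    where open ≡-Reasoning
  same-entries (suc m) _ | tri> _ _ l<1+m | 1+m<1+n = begin
    entry (inverseB (suc n) σ) (suc m) ≡⟨ entry-inverseB (suc n) σ (suc m) 1+m<1+n ⟩
    invAt (suc (suc m)) 1 σ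
      ≡⟨ invAt-insert-other (suc (suc m)) 1 k _ v (λ eq → ℕP.<-irrefl (trans (sym ∣v∣≡) eq) (s≤s l<1+m))
                            (s≤s z≤n) k≤∣w∣ ⟩
    shiftB (suc k) (invAt (suc (suc m)) 1 (map (shiftB (suc l)) w))
      ≡⟨ cong (shiftB (suc k)) (invAt-map (shiftB (suc l)) (suc (suc m)) (suc m)
                 (λ x → ∣shiftB∣≡-above (suc l) (suc m) x l<1+m)
                 (λ x → ∣shiftB∣≡-above⁻ (suc l) (suc m) x l<1+m) (sign-shiftB {suc l}) 1 w) ⟩
    shiftB (suc k) (invAt (suc m) 1 w) ≡⟨ sym (entry-shifted⁻¹ m (ℕP.≤-pred 1+m<1+n)) ⟩
    entry shifted⁻¹ m                   ≡⟨ sym (entry-insert-> m l shifted⁻¹ v' (ℕP.≤-pred l<1+m) l≤∣w⁻¹∣) ⟩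
    entry (insertAt (suc l) v' shifted⁻¹) (suc m) ∎
    where open ≡-Reasoning

word₀ : List ℤ → ℕ → ℤ
word₀ w = entry (+ 0 ∷ w)

-- The change of des^B when a value is inserted right after x_k in x₀ x₁ ⋯ x_n, where
-- `below a` says that the inserted value is smaller than (the shifted) a.
descentGain : (ℤ → Bool) → (ℕ → ℤ) → ℕ → ℕ → ℤ
descentGain below x n k =
  𝕀 (below (x k)) + 𝕀 (k ℕ.<ᵇ n) * (𝕀 (not (below (x (suc k)))) - ⟦ x (suc k) < x k ⟧)

desB-insert : ∀ n (w : List ℤ) k j v → length w ≡ n → k ℕ.≤ n →
  + desB (insertAt (suc k) v (map (shiftB (suc j)) w)) - + desB w
  ≡ ⟦ v < shiftB (suc j) (word₀ w k) ⟧
    + 𝕀 (k ℕ.<ᵇ n) * (⟦ shiftB (suc j) (word₀ w (suc k)) < v ⟧ - ⟦ word₀ w (suc k) < word₀ w k ⟧)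
desB-insert n w k j v ∣w∣≡n k≤n = begin
  + desB (insertAt (suc k) v W) - + desB w
    ≡⟨ cong (_- + desB w) (descents-insert k (+ 0) W v k≤∣W∣) ⟩
  + descents (+ 0 ∷ W) + ⟦ v < y k ⟧ + 𝕀 (k ℕ.<ᵇ length W) * (⟦ y (suc k) < v ⟧ - ⟦ y (suc k) < y k ⟧)
    - + desB w
    ≡⟨ cong₂ (λ a b → + a + ⟦ v < y k ⟧ + 𝕀 b * (⟦ y (suc k) < v ⟧ - ⟦ y (suc k) < y k ⟧) - + desB w)
             descents-W (cong (k ℕ.<ᵇ_) ∣W∣≡n) ⟩
  + desB w + ⟦ v < y k ⟧ + notLast * (⟦ y (suc k) < v ⟧ - ⟦ y (suc k) < y k ⟧) - + desB w
    ≡⟨ cancel (+ desB w) ⟦ v < y k ⟧ (notLast * (⟦ y (suc k) < v ⟧ - ⟦ y (suc k) < y k ⟧)) ⟩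
  ⟦ v < y k ⟧ + notLast * (⟦ y (suc k) < v ⟧ - ⟦ y (suc k) < y k ⟧)
    ≡⟨ cong₂ (λ a b → ⟦ v < a ⟧ + notLast * (⟦ b < v ⟧ - ⟦ y (suc k) < y k ⟧)) (y≡ k) (y≡ (suc k)) ⟩
  ⟦ v < σ (x k) ⟧ + notLast * (⟦ σ (x (suc k)) < v ⟧ - ⟦ y (suc k) < y k ⟧)
    ≡⟨ cong (λ z → ⟦ v < σ (x k) ⟧ + notLast * (⟦ σ (x (suc k)) < v ⟧ - 𝕀 z))
            (trans (cong₂ (λ a b → does (a ℤ.<? b)) (y≡ (suc k)) (y≡ k)) (shiftB-<-iff (suc j) (x k) (x (suc k)))) ⟩
  ⟦ v < σ (x k) ⟧ + notLast * (⟦ σ (x (suc k)) < v ⟧ - ⟦ x (suc k) < x k ⟧) ∎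
  where
  open ≡-Reasoning
  σ = shiftB (suc j)
  x = word₀ w
  W = map σ w
  y = entry (+ 0 ∷ W)
  notLast = 𝕀 (k ℕ.<ᵇ n)
  ∣W∣≡n : length W ≡ n
  ∣W∣≡n = trans (ListP.length-map σ w) ∣w∣≡n
  k≤∣W∣ : k ℕ.≤ length W
  k≤∣W∣ = subst (k ℕ.≤_) (sym ∣W∣≡n) k≤n
  y≡ : ∀ i → y i ≡ σ (x i)
  y≡ zero = refl
  y≡ (suc i) = entry-map σ refl w i
  descents-W : descents (+ 0 ∷ W) ≡ desB w
  descents-W = descents-map σ (shiftB-<-iff (suc j)) (+ 0 ∷ w)
  cancel : ∀ d a b → d + a + b - d ≡ a + b
  cancel = solve-∀

atLeast+ : ℕ → ℤ → Bool
atLeast+ j a = does (+ j ℤ.≤? a)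

above- : ℕ → ℤ → Bool
above- j a = does (-[1+ j ] ℤ.<? a)

desB-φ : ∀ n (w : List ℤ) k j → length w ≡ n → k ℕ.≤ n →
  + desB (φ (suc k) (suc j) w) - + desB w ≡ descentGain (atLeast+ (suc j)) (word₀ w) n k
desB-φ n w k j ∣w∣≡n k≤n = trans (desB-insert n w k j (+ suc j) ∣w∣≡n k≤n)
  (cong₂ (λ a b → 𝕀 a + 𝕀 (k ℕ.<ᵇ n) * (𝕀 b - ⟦ word₀ w (suc k) < word₀ w k ⟧))
     (+j<shiftB-iff (suc j) (word₀ w k))
     (trans (shiftB-<-flip (suc j) (word₀ w (suc k)) (+ suc j) refl)
            (cong not (+j<shiftB-iff (suc j) (word₀ w (suc k))))))

desB-φ̄ : ∀ n (w : List ℤ) k j → length w ≡ n → k ℕ.≤ n →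
  + desB (φ̄ (suc k) (suc j) w) - + desB w ≡ descentGain (above- j) (word₀ w) n k
desB-φ̄ n w k j ∣w∣≡n k≤n = trans (desB-insert n w k j -[1+ j ] ∣w∣≡n k≤n)
  (cong₂ (λ a b → 𝕀 a + 𝕀 (k ℕ.<ᵇ n) * (𝕀 b - ⟦ word₀ w (suc k) < word₀ w k ⟧))
     (-j<shiftB-iff j (word₀ w k))
     (trans (shiftB-<-flip (suc j) (word₀ w (suc k)) -[1+ j ] refl)
            (cong not (-j<shiftB-iff j (word₀ w (suc k))))))

idesB-φ : ∀ n (w : List ℤ) k j → length w ≡ n → k ℕ.≤ n → j ℕ.≤ n →
  + idesB (suc n) (φ (suc k) (suc j) w) - + idesB n w
  ≡ descentGain (atLeast+ (suc k)) (word₀ (inverseB n w)) n j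
idesB-φ n w k j ∣w∣≡n k≤n j≤n =
  trans (cong (λ z → + desB z - + idesB n w) (inverseB-insert n w k j (+ suc j) ∣w∣≡n k≤n j≤n refl))
        (desB-φ n (inverseB n w) j k (length-inverseB n w) j≤n)

idesB-φ̄ : ∀ n (w : List ℤ) k j → length w ≡ n → k ℕ.≤ n → j ℕ.≤ n →
  + idesB (suc n) (φ̄ (suc k) (suc j) w) - + idesB n w
  ≡ descentGain (above- k) (word₀ (inverseB n w)) n j
idesB-φ̄ n w k j ∣w∣≡n k≤n j≤n =
  trans (cong (λ z → + desB z - + idesB n w) (inverseB-insert n w k j -[1+ j ] ∣w∣≡n k≤n j≤n refl))
        (desB-φ̄ n (inverseB n w) j k (length-inverseB n w) j≤n)

UpwardClosed : (ℤ → Bool) → Set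
UpwardClosed P = ∀ a b → a ℤ.≤ b → P a ≡ true → P b ≡ true

atLeast+-upward : ∀ j → UpwardClosed (atLeast+ j)
atLeast+-upward j a b a≤b Pa with + j ℤ.≤? a | + j ℤ.≤? b
... | yes _ | yes _ = refl
... | yes j≤a | no j≰b = ⊥-elim (j≰b (ℤP.≤-trans j≤a a≤b))

above--upward : ∀ j → UpwardClosed (above- j)
above--upward j a b a≤b Pa with -[1+ j ] ℤ.<? a | -[1+ j ] ℤ.<? b
... | yes _ | yes _ = refl
... | yes j<a | no j≮b = ⊥-elim (j≮b (ℤP.<-≤-trans j<a a≤b))

Bit : ℤ → Set
Bit a = a ≡ 0ℤ ⊎ a ≡ 1ℤ

descentGain-bit : ∀ P x n k → UpwardClosed P → Bit (descentGain P x n k)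
descentGain-bit P x n k up
  with P (x k) in Pxₖ | k ℕ.<ᵇ n | P (x (suc k)) in Pxₖ₊₁ | x (suc k) ℤ.<? x k
... | false | false | _     | _     = inj₁ refl
... | true  | false | _     | _     = inj₂ refl
... | false | true  | false | yes _ = inj₁ refl
... | false | true  | false | no _  = inj₂ refl
... | false | true  | true  | no _  = inj₁ refl
... | true  | true  | true  | yes _ = inj₁ refl
... | true  | true  | true  | no _  = inj₂ refl
... | true  | true  | false | yes _ = inj₂ refl
... | false | true  | true  | yes lt
    with () ← trans (sym (up (x (suc k)) (x k) (ℤP.<⇒≤ lt) Pxₖ₊₁)) Pxₖ
... | true  | true  | false | no ≮
    with () ← trans (sym (up (x k) (x (suc k)) (ℤP.≮⇒≥ ≮) Pxₖ)) Pxₖ₊₁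

pairIs-11 : ∀ {a b} → Bit a → Bit b → 𝕀 (pairIs (a , b) 1ℤ 1ℤ) ≡ a * b
pairIs-11 (inj₁ refl) (inj₁ refl) = refl
pairIs-11 (inj₁ refl) (inj₂ refl) = refl
pairIs-11 (inj₂ refl) (inj₁ refl) = refl
pairIs-11 (inj₂ refl) (inj₂ refl) = refl

pairIs-10 : ∀ {a b} → Bit a → Bit b → 𝕀 (pairIs (a , b) 1ℤ 0ℤ) ≡ a * (1ℤ - b)
pairIs-10 (inj₁ refl) (inj₁ refl) = refl
pairIs-10 (inj₁ refl) (inj₂ refl) = refl
pairIs-10 (inj₂ refl) (inj₁ refl) = refl
pairIs-10 (inj₂ refl) (inj₂ refl) = refl

pairIs-01 : ∀ {a b} → Bit a → Bit b → 𝕀 (pairIs (a , b) 0ℤ 1ℤ) ≡ (1ℤ - a) * b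
pairIs-01 (inj₁ refl) (inj₁ refl) = refl
pairIs-01 (inj₁ refl) (inj₂ refl) = refl
pairIs-01 (inj₂ refl) (inj₁ refl) = refl
pairIs-01 (inj₂ refl) (inj₂ refl) = refl

pairIs-00 : ∀ {a b} → Bit a → Bit b → 𝕀 (pairIs (a , b) 0ℤ 0ℤ) ≡ (1ℤ - a) * (1ℤ - b)
pairIs-00 (inj₁ refl) (inj₁ refl) = refl
pairIs-00 (inj₁ refl) (inj₂ refl) = refl
pairIs-00 (inj₂ refl) (inj₁ refl) = refl
pairIs-00 (inj₂ refl) (inj₂ refl) = refl

𝕀-+-not : ∀ b → 𝕀 b + 𝕀 (not b) ≡ 1ℤ
𝕀-+-not true = refl
𝕀-+-not false = refl

∑-𝕀-+-𝕀-not-next : ∀ n (p : ℕ → Bool) →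
  ∑ (suc n) (λ k → 𝕀 (p k) + 𝕀 (k ℕ.<ᵇ n) * 𝕀 (not (p (suc k)))) ≡ 𝕀 (p 0) + + n
∑-𝕀-+-𝕀-not-next n p = begin
  ∑ (suc n) (λ k → 𝕀 (p k) + 𝕀 (k ℕ.<ᵇ n) * 𝕀 (not (p (suc k))))
    ≡⟨ ∑-+ (suc n) (λ k → 𝕀 (p k)) (λ k → 𝕀 (k ℕ.<ᵇ n) * 𝕀 (not (p (suc k)))) ⟩
  𝕀 (p 0) + ∑ n (λ k → 𝕀 (p (suc k))) + ∑ (suc n) (λ k → 𝕀 (k ℕ.<ᵇ n) * 𝕀 (not (p (suc k))))
    ≡⟨ cong (λ z → 𝕀 (p 0) + ∑ n (λ k → 𝕀 (p (suc k))) + z) (∑-dropLast n (λ k → 𝕀 (not (p (suc k))))) ⟩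
  𝕀 (p 0) + ∑ n (λ k → 𝕀 (p (suc k))) + ∑ n (λ k → 𝕀 (not (p (suc k))))
    ≡⟨ ℤP.+-assoc (𝕀 (p 0)) _ _ ⟩
  𝕀 (p 0) + (∑ n (λ k → 𝕀 (p (suc k))) + ∑ n (λ k → 𝕀 (not (p (suc k)))))
    ≡⟨ cong (λ z → 𝕀 (p 0) + z) (sym (∑-+ n (λ k → 𝕀 (p (suc k))) (λ k → 𝕀 (not (p (suc k)))))) ⟩
  𝕀 (p 0) + ∑ n (λ k → 𝕀 (p (suc k)) + 𝕀 (not (p (suc k))))
    ≡⟨ cong (λ z → 𝕀 (p 0) + z) (trans (∑-cong n (λ k → 𝕀-+-not (p (suc k)))) (∑-1 n)) ⟩
  𝕀 (p 0) + + n ∎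
  where open ≡-Reasoning

∑∑-sub-row : ∀ N (R : ℕ → ℕ → ℤ) (D : ℕ → ℤ) r → (∀ l → ∑ N (λ k → R k l) ≡ r) →
  ∑∑ N (λ k l → R k l - D k) ≡ + N * r - + N * ∑ N D
∑∑-sub-row N R D r colSum =
  trans (∑-cong N (λ k → trans (∑-- N (R k) (λ _ → D k)) (cong (λ z → ∑ N (R k) - z) (∑-const N (D k)))))
  (trans (∑-- N (λ k → ∑ N (R k)) (λ k → + N * D k))
         (cong₂ _-_ (trans (∑-swap N N R) (trans (∑-cong N colSum) (∑-const N r))) (∑-*ˡ N (+ N) D)))

∑∑-sub-column : ∀ N (R : ℕ → ℕ → ℤ) (E : ℕ → ℤ) r → (∀ k → ∑ N (R k) ≡ r) →
  ∑∑ N (λ k l → R k l - E l) ≡ + N * (r - ∑ N E)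
∑∑-sub-column N R E r rowSum =
  trans (∑-cong N (λ k → trans (∑-- N (R k) E) (cong (_- ∑ N E) (rowSum k)))) (∑-const N (r - ∑ N E))

∑∑-*-sub : ∀ N (R R' : ℕ → ℕ → ℤ) (D E : ℕ → ℤ) r r' →
  (∀ l → ∑ N (λ k → R k l) ≡ r) → (∀ k → ∑ N (R' k) ≡ r') →
  ∑∑ N (λ k l → (R k l - D k) * (R' k l - E l))
  ≡ ∑∑ N (λ k l → R k l * R' k l) - ∑ N D * r' - ∑ N E * r + ∑ N D * ∑ N E
∑∑-*-sub N R R' D E r r' colSum rowSum' =
  trans (∑-cong N row)
  (trans (∑-+ N (λ k → ∑ N (RR' k) - D k * r' - ER k) (λ k → D k * ∑ N E))
  (cong₂ _+_ (trans (∑-- N (λ k → ∑ N (RR' k) - D k * r') ER)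
                    (cong₂ _-_ (trans (∑-- N (λ k → ∑ N (RR' k)) (λ k → D k * r'))
                                      (cong (λ z → ∑∑ N RR' - z) (∑-*ʳ N r' D)))
                               ∑ER))
             (∑-*ʳ N (∑ N E) D)))
  where
  RR' : ℕ → ℕ → ℤ
  RR' k l = R k l * R' k l
  ER : ℕ → ℤ
  ER k = ∑ N (λ l → E l * R k l)
  expand : ∀ a d b e → (a - d) * (b - e) ≡ a * b - d * b - e * a + d * e
  expand = solve-∀
  row : ∀ k → ∑ N (λ l → (R k l - D k) * (R' k l - E l)) ≡ ∑ N (RR' k) - D k * r' - ER k + D k * ∑ N E
  row k =
    trans (∑-cong N (λ l → expand (R k l) (D k) (R' k l) (E l)))
    (trans (∑-+ N (λ l → RR' k l - D k * R' k l - E l * R k l) (λ l → D k * E l))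
    (cong₂ _+_ (trans (∑-- N (λ l → RR' k l - D k * R' k l) (λ l → E l * R k l))
                 (cong (_- ER k) (trans (∑-- N (RR' k) (λ l → D k * R' k l))
                                   (cong (λ z → ∑ N (RR' k) - z)
                                         (trans (∑-*ˡ N (D k) (R' k)) (cong (D k *_) (rowSum' k)))))))
               (∑-*ˡ N (D k) E)))
  ∑ER : ∑ N ER ≡ ∑ N E * r
  ∑ER = trans (∑-swap N N (λ k l → E l * R k l))
        (trans (∑-cong N (λ l → trans (∑-*ˡ N (E l) (λ k → R k l)) (cong (E l *_) (colSum l))))
               (∑-*ʳ N r E))

module TypeCounts (M : ℕ) (Δ : ℕ → ℕ → ℤ × ℤ) (dd di : ℕ → ℕ → ℤ)
  (Δ≡ : ∀ k l → k ℕ.< M → l ℕ.< M → Δ k l ≡ (dd k l , di k l))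
  (dd-bit : ∀ k l → Bit (dd k l)) (di-bit : ∀ k l → Bit (di k l)) where

  count : ℤ → ℤ → ℤ
  count a b = ∑∑ M (λ k l → 𝕀 (pairIs (Δ k l) a b))

  ∑∑dd*di : ℤ
  ∑∑dd*di = ∑∑ M (λ k l → dd k l * di k l)

  private
    count-as : ∀ a b (F : ℤ → ℤ → ℤ) → (∀ k l → 𝕀 (pairIs (dd k l , di k l) a b) ≡ F (dd k l) (di k l)) →
      count a b ≡ ∑∑ M (λ k l → F (dd k l) (di k l))
    count-as a b F F≡ = ∑-cong-< M (λ k k<M → ∑-cong-< M (λ l l<M →
      trans (cong (λ z → 𝕀 (pairIs z a b)) (Δ≡ k l k<M l<M)) (F≡ k l)))

  count-11 : count 1ℤ 1ℤ ≡ ∑∑dd*di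
  count-11 = count-as 1ℤ 1ℤ _*_ (λ k l → pairIs-11 (dd-bit k l) (di-bit k l))

  count-10 : count 1ℤ 0ℤ ≡ ∑∑ M dd - ∑∑dd*di
  count-10 = trans (count-as 1ℤ 0ℤ (λ a b → a * (1ℤ - b)) (λ k l → pairIs-10 (dd-bit k l) (di-bit k l)))
             (trans (∑∑-cong M (λ k l → ring (dd k l) (di k l))) (∑∑-- M dd (λ k l → dd k l * di k l)))
    where
    ring : ∀ a b → a * (1ℤ - b) ≡ a - a * b
    ring = solve-∀

  count-01 : count 0ℤ 1ℤ ≡ ∑∑ M di - ∑∑dd*di
  count-01 = trans (count-as 0ℤ 1ℤ (λ a b → (1ℤ - a) * b) (λ k l → pairIs-01 (dd-bit k l) (di-bit k l)))
             (trans (∑∑-cong M (λ k l → ring (dd k l) (di k l))) (∑∑-- M di (λ k l → dd k l * di k l)))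
    where
    ring : ∀ a b → (1ℤ - a) * b ≡ b - a * b
    ring = solve-∀

  count-00 : count 0ℤ 0ℤ ≡ + M * + M - ∑∑ M dd - ∑∑ M di + ∑∑dd*di
  count-00 = begin
    count 0ℤ 0ℤ
      ≡⟨ count-as 0ℤ 0ℤ (λ a b → (1ℤ - a) * (1ℤ - b)) (λ k l → pairIs-00 (dd-bit k l) (di-bit k l)) ⟩
    ∑∑ M (λ k l → (1ℤ - dd k l) * (1ℤ - di k l))
      ≡⟨ ∑∑-cong M (λ k l → ring (dd k l) (di k l)) ⟩
    ∑∑ M (λ k l → 1ℤ - dd k l - di k l + dd k l * di k l)
      ≡⟨ ∑∑-+ M (λ k l → 1ℤ - dd k l - di k l) (λ k l → dd k l * di k l) ⟩
    ∑∑ M (λ k l → 1ℤ - dd k l - di k l) + ∑∑dd*di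
      ≡⟨ cong (_+ ∑∑dd*di) (∑∑-- M (λ k l → 1ℤ - dd k l) di) ⟩
    ∑∑ M (λ k l → 1ℤ - dd k l) - ∑∑ M di + ∑∑dd*di
      ≡⟨ cong (λ z → z - ∑∑ M di + ∑∑dd*di)
              (trans (∑∑-- M (λ _ _ → 1ℤ) dd) (cong (_- ∑∑ M dd) (∑∑-1 M))) ⟩
    + M * + M - ∑∑ M dd - ∑∑ M di + ∑∑dd*di ∎
    where
    open ≡-Reasoning
    ring : ∀ a b → (1ℤ - a) * (1ℤ - b) ≡ 1ℤ - a - b + a * b
    ring = solve-∀

-- The summand of ∑∑ R·R' at an interior point (k+1, l+1) after reindexing: the four
-- cross terms of the product, each taken at the point where it is not guarded.
crossCount : (a₁ a₀ g₁ g₀ : Bool) → ℤ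
crossCount a₁ a₀ g₁ g₀ =
  𝕀 a₁ * 𝕀 g₁ + 𝕀 a₀ * 𝕀 (not g₁) + 𝕀 (not a₁) * 𝕀 g₀ + 𝕀 (not a₀) * 𝕀 (not g₀)

crossCount-diagonal : ∀ a g → crossCount a a g g ≡ 1ℤ
crossCount-diagonal true true = refl
crossCount-diagonal true false = refl
crossCount-diagonal false true = refl
crossCount-diagonal false false = refl

module ProductSum (n : ℕ) (x y : ℕ → ℤ) (P Q : ℕ → ℤ → Bool) where

  R R' : ℕ → ℕ → ℤ
  R k l = 𝕀 (P l (x k)) + 𝕀 (k ℕ.<ᵇ n) * 𝕀 (not (P l (x (suc k))))
  R' k l = 𝕀 (Q k (y l)) + 𝕀 (l ℕ.<ᵇ n) * 𝕀 (not (Q k (y (suc l))))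

  private
    t₁ t₂ t₃ t₄ : ℕ → ℕ → ℤ
    t₁ k l = 𝕀 (P l (x k)) * 𝕀 (Q k (y l))
    t₂ k l = 𝕀 (P l (x k)) * 𝕀 (not (Q k (y (suc l))))
    t₃ k l = 𝕀 (not (P l (x (suc k)))) * 𝕀 (Q k (y l))
    t₄ k l = 𝕀 (not (P l (x (suc k)))) * 𝕀 (not (Q k (y (suc l))))

    t₂⁺ t₃⁺ t₄⁺ : ℕ → ℕ → ℤ
    t₂⁺ k zero = 0ℤ
    t₂⁺ k (suc l) = t₂ k l
    t₃⁺ zero l = 0ℤ
    t₃⁺ (suc k) l = t₃ k l
    t₄⁺ zero l = 0ℤ
    t₄⁺ (suc k) zero = 0ℤ
    t₄⁺ (suc k) (suc l) = t₄ k l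

    guarded₂ guarded₃ guarded₄ : ℕ → ℕ → ℤ
    guarded₂ k l = 𝕀 (l ℕ.<ᵇ n) * t₂ k l
    guarded₃ k l = 𝕀 (k ℕ.<ᵇ n) * t₃ k l
    guarded₄ k l = 𝕀 (k ℕ.<ᵇ n) * (𝕀 (l ℕ.<ᵇ n) * t₄ k l)

    expand : ∀ k l → R k l * R' k l ≡ t₁ k l + guarded₂ k l + guarded₃ k l + guarded₄ k l
    expand k l = ring (𝕀 (P l (x k))) (𝕀 (k ℕ.<ᵇ n)) (𝕀 (not (P l (x (suc k)))))
                      (𝕀 (Q k (y l))) (𝕀 (l ℕ.<ᵇ n)) (𝕀 (not (Q k (y (suc l)))))
      where
      ring : ∀ a g a' b h b' → (a + g * a') * (b + h * b') ≡ a * b + h * (a * b') + g * (a' * b) + g * (h * (a' * b'))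
      ring = solve-∀

    shift₂ : ∑∑ (suc n) guarded₂ ≡ ∑∑ (suc n) t₂⁺
    shift₂ = ∑-cong (suc n) (λ k → trans (∑-dropLast n (t₂ k)) (sym (ℤP.+-identityˡ _)))

    shift₃ : ∑∑ (suc n) guarded₃ ≡ ∑∑ (suc n) t₃⁺
    shift₃ = trans (∑-cong (suc n) (λ k → ∑-*ˡ (suc n) (𝕀 (k ℕ.<ᵇ n)) (t₃ k)))
             (trans (∑-dropLast n (λ k → ∑ (suc n) (t₃ k)))
                    (sym (trans (cong (_+ ∑ n (λ k → ∑ (suc n) (t₃ k))) (∑-zero (suc n))) (ℤP.+-identityˡ _))))

    shift₄ : ∑∑ (suc n) guarded₄ ≡ ∑∑ (suc n) t₄⁺
    shift₄ = trans (∑-cong (suc n) (λ k → ∑-*ˡ (suc n) (𝕀 (k ℕ.<ᵇ n)) (λ l → 𝕀 (l ℕ.<ᵇ n) * t₄ k l)))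
             (trans (∑-dropLast n (λ k → ∑ (suc n) (λ l → 𝕀 (l ℕ.<ᵇ n) * t₄ k l)))
             (trans (∑-cong n (λ k → trans (∑-dropLast n (t₄ k)) (sym (ℤP.+-identityˡ _))))
                    (sym (trans (cong (_+ ∑ n (λ k → ∑ (suc n) (t₄⁺ (suc k)))) (∑-zero (suc n))) (ℤP.+-identityˡ _)))))

  reindexed : ℕ → ℕ → ℤ
  reindexed k l = t₁ k l + t₂⁺ k l + t₃⁺ k l + t₄⁺ k l

  ∑∑-R*R' : ∑∑ (suc n) (λ k l → R k l * R' k l) ≡ ∑∑ (suc n) reindexed
  ∑∑-R*R' = begin
    ∑∑ (suc n) (λ k l → R k l * R' k l)
      ≡⟨ ∑∑-cong (suc n) expand ⟩
    ∑∑ (suc n) (λ k l → t₁ k l + guarded₂ k l + guarded₃ k l + guarded₄ k l)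
      ≡⟨ split t₁ guarded₂ guarded₃ guarded₄ ⟩
    ∑∑ (suc n) t₁ + ∑∑ (suc n) guarded₂ + ∑∑ (suc n) guarded₃ + ∑∑ (suc n) guarded₄
      ≡⟨ cong₂ _+_ (cong₂ _+_ (cong (_+_ (∑∑ (suc n) t₁)) shift₂) shift₃) shift₄ ⟩
    ∑∑ (suc n) t₁ + ∑∑ (suc n) t₂⁺ + ∑∑ (suc n) t₃⁺ + ∑∑ (suc n) t₄⁺
      ≡⟨ sym (split t₁ t₂⁺ t₃⁺ t₄⁺) ⟩
    ∑∑ (suc n) reindexed ∎
    where
    open ≡-Reasoning
    split : ∀ f g h i → ∑∑ (suc n) (λ k l → f k l + g k l + h k l + i k l)
                       ≡ ∑∑ (suc n) f + ∑∑ (suc n) g + ∑∑ (suc n) h + ∑∑ (suc n) i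
    split f g h i =
      trans (∑∑-+ (suc n) (λ k l → f k l + g k l + h k l) i)
            (cong (_+ ∑∑ (suc n) i) (trans (∑∑-+ (suc n) (λ k l → f k l + g k l) h)
                                           (cong (_+ ∑∑ (suc n) h) (∑∑-+ (suc n) f g))))

atLeast+-step : ∀ j a → a ≢ + j → atLeast+ (suc j) a ≡ atLeast+ j a
atLeast+-step j a a≢j =
  does-⇔ (mk⇔ (ℤP.≤-trans (+≤+ (ℕP.n≤1+n j))) (λ j≤a → suc-≤ (ℤP.≤∧≢⇒< j≤a (a≢j ∘ sym))))
         (+ suc j ℤ.≤? a) (+ j ℤ.≤? a)
  where
  suc-≤ : + j ℤ.< a → + suc j ℤ.≤ a
  suc-≤ (+<+ lt) = +≤+ lt

above--step : ∀ j a → a ≢ -[1+ j ] → above- (suc j) a ≡ above- j a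
above--step j a a≢j = does-⇔ (mk⇔ pred-< (ℤP.<-trans (-<- (ℕP.n<1+n j)))) (-[1+ suc j ] ℤ.<? a) (-[1+ j ] ℤ.<? a)
  where
  pred-< : -[1+ suc j ] ℤ.< a → -[1+ j ] ℤ.< a
  pred-< -<+ = -<+
  pred-< (-<- lt) = -<- (ℕP.≤∧≢⇒< (ℕP.≤-pred lt) (λ eq → a≢j (cong -[1+_] eq)))

atLeast+-threshold : ∀ j → atLeast+ (suc j) (+ j) ≡ false × atLeast+ j (+ j) ≡ true
atLeast+-threshold j = dec-false (+ suc j ℤ.≤? + j) (λ { (+≤+ lt) → ℕP.<-irrefl refl lt })
                     , dec-true (+ j ℤ.≤? + j) ℤP.≤-refl

above--threshold : ∀ j → above- (suc j) -[1+ j ] ≡ true × above- j -[1+ j ] ≡ false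
above--threshold j = dec-true (-[1+ suc j ] ℤ.<? -[1+ j ]) (-<- (ℕP.n<1+n j))
                   , dec-false (-[1+ j ] ℤ.<? -[1+ j ]) (ℤP.<-irrefl refl)

-- At an interior point the threshold changes between l and l+1 only at the value ±(l+1),
-- so crossCount is 1 there except at the points (k+1, l+1) with x_{k+1} = ±(l+1), where it is 2.
module ProductSum⁺ (n : ℕ) (x y : ℕ → ℤ) (x₀ : x 0 ≡ + 0) (y₀ : y 0 ≡ + 0)
  (x⇔y : ∀ k l → k ℕ.< n → l ℕ.< n → (x (suc k) ≡ + suc l) ⇔ (y (suc l) ≡ + suc k)) where
  open ProductSum n x y (λ l → atLeast+ (suc l)) (λ k → atLeast+ (suc k))

  hit : ℕ → ℕ → ℤ
  hit k l = 𝕀 (does (x (suc k) ℤ.≟ + suc l))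

  private
    first-row : ∀ l → reindexed 0 l ≡ 0ℤ
    first-row zero rewrite x₀ = refl
    first-row (suc l) rewrite x₀ = refl

    first-column : ∀ k → reindexed (suc k) 0 ≡ 0ℤ
    first-column k rewrite y₀ = ring (𝕀 (atLeast+ 1 (x (suc k)))) (𝕀 (not (atLeast+ 1 (x (suc k)))))
      where
      ring : ∀ a b → a * 0ℤ + 0ℤ + b * 0ℤ + 0ℤ ≡ 0ℤ
      ring = solve-∀

    interior : ∀ k l → k ℕ.< n → l ℕ.< n → reindexed (suc k) (suc l) ≡ 1ℤ + hit k l
    interior k l k<n l<n with x (suc k) ℤ.≟ + suc l
    ... | yes eq rewrite eq | Equivalence.to (x⇔y k l k<n l<n) eq
        | proj₁ (atLeast+-threshold (suc l)) | proj₂ (atLeast+-threshold (suc l))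
        | proj₁ (atLeast+-threshold (suc k)) | proj₂ (atLeast+-threshold (suc k)) = refl
    ... | no ≢ rewrite atLeast+-step (suc l) (x (suc k)) ≢
        | atLeast+-step (suc k) (y (suc l)) (≢ ∘ Equivalence.from (x⇔y k l k<n l<n))
        = crossCount-diagonal (atLeast+ (suc l) (x (suc k))) (atLeast+ (suc k) (y (suc l)))

  ∑∑-R*R'-value : ∑∑ (suc n) (λ k l → R k l * R' k l) ≡ + n * + n + ∑∑ n hit
  ∑∑-R*R'-value = begin
    ∑∑ (suc n) (λ k l → R k l * R' k l)  ≡⟨ ∑∑-R*R' ⟩
    ∑ (suc n) (reindexed 0) + ∑ n (λ k → reindexed (suc k) 0 + ∑ n (λ l → reindexed (suc k) (suc l)))
      ≡⟨ cong₂ _+_ (trans (∑-cong (suc n) first-row) (∑-zero (suc n)))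
                   (∑-cong-< n (λ k k<n → cong₂ _+_ (first-column k) (∑-cong-< n (λ l l<n → interior k l k<n l<n)))) ⟩
    0ℤ + ∑ n (λ k → 0ℤ + ∑ n (λ l → 1ℤ + hit k l))
      ≡⟨ trans (ℤP.+-identityˡ _) (∑-cong n (λ k → trans (ℤP.+-identityˡ _) (∑-+ n (λ _ → 1ℤ) (hit k)))) ⟩
    ∑ n (λ k → ∑ n (λ _ → 1ℤ) + ∑ n (hit k))
      ≡⟨ ∑-+ n (λ _ → ∑ n (λ _ → 1ℤ)) (λ k → ∑ n (hit k)) ⟩
    ∑∑ n (λ _ _ → 1ℤ) + ∑∑ n hit  ≡⟨ cong (_+ ∑∑ n hit) (∑∑-1 n) ⟩
    + n * + n + ∑∑ n hit ∎
    where open ≡-Reasoning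

module ProductSum⁻ (n : ℕ) (x y : ℕ → ℤ) (x₀ : x 0 ≡ + 0) (y₀ : y 0 ≡ + 0)
  (x⇔y : ∀ k l → k ℕ.< n → l ℕ.< n → (x (suc k) ≡ -[1+ l ]) ⇔ (y (suc l) ≡ -[1+ k ])) where
  open ProductSum n x y above- above-

  hit : ℕ → ℕ → ℤ
  hit k l = 𝕀 (does (x (suc k) ℤ.≟ -[1+ l ]))

  private
    first-row : ∀ l → reindexed 0 l ≡ 1ℤ
    first-row zero rewrite x₀ | y₀ = refl
    first-row (suc l) rewrite x₀ = ring (above- 0 (y (suc l)))
      where
      ring : ∀ c → 1ℤ * 𝕀 c + 1ℤ * 𝕀 (not c) + 0ℤ + 0ℤ ≡ 1ℤ
      ring true = refl
      ring false = refl

    first-column : ∀ k → reindexed (suc k) 0 ≡ 1ℤ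
    first-column k rewrite y₀ = ring (above- 0 (x (suc k)))
      where
      ring : ∀ c → 𝕀 c * 1ℤ + 0ℤ + 𝕀 (not c) * 1ℤ + 0ℤ ≡ 1ℤ
      ring true = refl
      ring false = refl

    interior : ∀ k l → k ℕ.< n → l ℕ.< n → reindexed (suc k) (suc l) ≡ 1ℤ + hit k l
    interior k l k<n l<n with x (suc k) ℤ.≟ -[1+ l ]
    ... | yes eq rewrite eq | Equivalence.to (x⇔y k l k<n l<n) eq
        | proj₁ (above--threshold l) | proj₂ (above--threshold l)
        | proj₁ (above--threshold k) | proj₂ (above--threshold k) = refl
    ... | no ≢ rewrite above--step l (x (suc k)) ≢
        | above--step k (y (suc l)) (≢ ∘ Equivalence.from (x⇔y k l k<n l<n))
        = crossCount-diagonal (above- l (x (suc k))) (above- k (y (suc l)))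

  ∑∑-R*R'-value : ∑∑ (suc n) (λ k l → R k l * R' k l) ≡ + suc n * + suc n + ∑∑ n hit
  ∑∑-R*R'-value = begin
    ∑∑ (suc n) (λ k l → R k l * R' k l)  ≡⟨ ∑∑-R*R' ⟩
    ∑ (suc n) (reindexed 0) + ∑ n (λ k → reindexed (suc k) 0 + ∑ n (λ l → reindexed (suc k) (suc l)))
      ≡⟨ cong₂ _+_ (∑-cong (suc n) first-row)
                   (∑-cong-< n (λ k k<n → cong₂ _+_ (first-column k) (∑-cong-< n (λ l l<n → interior k l k<n l<n)))) ⟩
    ∑ (suc n) (λ _ → 1ℤ) + ∑ n (λ k → 1ℤ + ∑ n (λ l → 1ℤ + hit k l))
      ≡⟨ cong (_+_ (∑ (suc n) (λ _ → 1ℤ))) (∑-cong n (λ k → cong (_+_ 1ℤ) (∑-+ n (λ _ → 1ℤ) (hit k)))) ⟩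
    ∑ (suc n) (λ _ → 1ℤ) + ∑ n (λ k → 1ℤ + (∑ n (λ _ → 1ℤ) + ∑ n (hit k)))
      ≡⟨ cong (_+_ (∑ (suc n) (λ _ → 1ℤ))) (∑-cong n (λ k → sym (ℤP.+-assoc 1ℤ (∑ n (λ _ → 1ℤ)) (∑ n (hit k))))) ⟩
    ∑ (suc n) (λ _ → 1ℤ) + ∑ n (λ k → 1ℤ + ∑ n (λ _ → 1ℤ) + ∑ n (hit k))
      ≡⟨ cong (_+_ (∑ (suc n) (λ _ → 1ℤ))) (∑-+ n (λ _ → 1ℤ + ∑ n (λ _ → 1ℤ)) (λ k → ∑ n (hit k))) ⟩
    ∑ (suc n) (λ _ → 1ℤ) + (∑ n (λ _ → 1ℤ + ∑ n (λ _ → 1ℤ)) + ∑∑ n hit)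
      ≡⟨ sym (ℤP.+-assoc (∑ (suc n) (λ _ → 1ℤ)) _ _) ⟩
    ∑∑ (suc n) (λ _ _ → 1ℤ) + ∑∑ n hit  ≡⟨ cong (_+ ∑∑ n hit) (∑∑-1 (suc n)) ⟩
    + suc n * + suc n + ∑∑ n hit ∎
    where open ≡-Reasoning

length-signedPerm : ∀ {n w} → IsSignedPerm n w → length w ≡ n
length-signedPerm {n} {w} π∈𝔅 =
  trans (sym (ListP.length-map ∣_∣ w)) (trans (↭-length π∈𝔅) (length-range1 n))

unique-∣signedPerm∣ : ∀ {n w} → IsSignedPerm n w → Unique (map ∣_∣ w)
unique-∣signedPerm∣ {n} π∈𝔅 =
  PermProps.Unique-resp-↭ (setoid ℕ) (↭⇒↭ₛ (↭-sym π∈𝔅)) (UniqueP.map⁺ ℕP.suc-injective (UniqueP.upTo⁺ n))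

entry-∈ : ∀ (w : List ℤ) k → k ℕ.< length w → entry w k ∈ w
entry-∈ (a ∷ w) zero _ = here refl
entry-∈ (a ∷ w) (suc k) (s≤s k<w) = there (entry-∈ w k k<w)

∣entry∣-signedPerm : ∀ {n w} → IsSignedPerm n w → ∀ k → k ℕ.< n →
  ∃ λ i → i ℕ.< n × ∣ entry w k ∣ ≡ suc i
∣entry∣-signedPerm {n} {w} π∈𝔅 k k<n
  with ∈-map⁻ suc (∈-resp-↭ π∈𝔅 (∈-map⁺ ∣_∣ (entry-∈ w k (subst (k ℕ.<_) (sym (length-signedPerm π∈𝔅)) k<n))))
... | i , i∈ , eq = i , ∈-upTo⁻ i∈ , eq

invAt-found : ∀ K s (w : List ℤ) →
  invAt K s w ≡ + 0 ⊎ ∃ λ p → ∣ entry w p ∣ ≡ K × invAt K s w ≡ sign (entry w p) ◃ (s ℕ.+ p)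
invAt-found K s [] = inj₁ refl
invAt-found K s (a ∷ w) with ∣ a ∣ ℕ.≟ K
... | yes eq = inj₂ (0 , eq , trans (invAt-hit K s a w eq) (cong (sign a ◃_) (sym (ℕP.+-identityʳ s))))
... | no ne with invAt-found K (suc s) w
...   | inj₁ absent = inj₁ (trans (invAt-miss K s a w ne) absent)
...   | inj₂ (p , eq , found) = inj₂ (suc p , eq ,
          trans (invAt-miss K s a w ne) (trans found (cong (sign (entry w p) ◃_) (sym (ℕP.+-suc s p)))))

invAt-entry : ∀ s (w : List ℤ) k → Unique (map ∣_∣ w) → k ℕ.< length w →
  invAt ∣ entry w k ∣ s w ≡ sign (entry w k) ◃ (s ℕ.+ k)
invAt-entry s (a ∷ w) zero _ _ =
  trans (invAt-hit ∣ a ∣ s a w refl) (cong (sign a ◃_) (sym (ℕP.+-identityʳ s)))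
invAt-entry s (a ∷ w) (suc k) (a∉ ∷ unique) (s≤s k<w) =
  trans (invAt-miss ∣ entry w k ∣ s a w (All-≢ a∉ (∈-map⁺ ∣_∣ (entry-∈ w k k<w))))
        (trans (invAt-entry (suc s) w k unique k<w) (cong (sign (entry w k) ◃_) (sym (ℕP.+-suc s k))))
  where
  All-≢ : ∀ {xs : List ℕ} {c d} → All (c ≢_) xs → d ∈ xs → c ≢ d
  All-≢ (c≢ ∷ _) (here refl) = c≢
  All-≢ (_ ∷ c≢s) (there d∈) = All-≢ c≢s d∈

entry≡⇔invAt≡ : ∀ {n w} → IsSignedPerm n w → ∀ (σ : Sign) k l → k ℕ.< n →
  (entry w k ≡ σ ◃ suc l) ⇔ (invAt (suc l) 1 w ≡ σ ◃ suc k)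
entry≡⇔invAt≡ {n} {w} π∈𝔅 σ k l k<n = mk⇔ to from
  where
  to : entry w k ≡ σ ◃ suc l → invAt (suc l) 1 w ≡ σ ◃ suc k
  to eq = trans (cong (λ z → invAt z 1 w) (trans (sym (ℤP.abs-◃ σ (suc l))) (cong ∣_∣ (sym eq))))
            (trans (invAt-entry 1 w k (unique-∣signedPerm∣ π∈𝔅) (subst (k ℕ.<_) (sym (length-signedPerm π∈𝔅)) k<n))
                   (cong (_◃ suc k) (trans (cong sign eq) (ℤP.sign-◃ σ (suc l)))))
  from : invAt (suc l) 1 w ≡ σ ◃ suc k → entry w k ≡ σ ◃ suc l
  from eq with invAt-found (suc l) 1 w
  ... | inj₁ absent = ⊥-elim (ℕP.0≢1+n (trans (cong ∣_∣ (trans (sym absent) eq)) (ℤP.abs-◃ σ (suc k))))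
  ... | inj₂ (p , ∣x∣≡ , found) = begin
    entry w k                       ≡⟨ cong (entry w) (sym p≡k) ⟩
    x                               ≡⟨ sym (ℤP.◃-inverse x) ⟩
    sign x ◃ ∣ x ∣                  ≡⟨ cong₂ _◃_ sign-x≡σ ∣x∣≡ ⟩
    σ ◃ suc l ∎
    where
    open ≡-Reasoning
    x = entry w p
    same : sign x ◃ suc p ≡ σ ◃ suc k
    same = trans (sym found) eq
    sign-x≡σ : sign x ≡ σ
    sign-x≡σ = trans (sym (ℤP.sign-◃ (sign x) (suc p))) (trans (cong sign same) (ℤP.sign-◃ σ (suc k)))
    p≡k : p ≡ k
    p≡k = ℕP.suc-injective (trans (sym (ℤP.abs-◃ (sign x) (suc p))) (trans (cong ∣_∣ same) (ℤP.abs-◃ σ (suc k))))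

∑-𝕀≡suc : ∀ n m → m ℕ.≤ n → ∑ n (λ l → 𝕀 (m ℕ.≡ᵇ suc l)) ≡ 𝕀 (0 ℕ.<ᵇ m)
∑-𝕀≡suc zero zero _ = refl
∑-𝕀≡suc (suc n) zero _ = trans (ℤP.+-identityˡ _) (∑-zero n)
∑-𝕀≡suc (suc n) (suc m) (s≤s m≤n) =
  trans (cong (_+_ (𝕀 (m ℕ.≡ᵇ 0))) (∑-𝕀≡suc n m m≤n)) (zero-or-suc m)
  where
  zero-or-suc : ∀ m → 𝕀 (m ℕ.≡ᵇ 0) + 𝕀 (0 ℕ.<ᵇ m) ≡ 1ℤ
  zero-or-suc zero = refl
  zero-or-suc (suc m) = refl

∑-𝕀≡ : ∀ n m → m ℕ.< n → ∑ n (λ l → 𝕀 (m ℕ.≡ᵇ l)) ≡ 1ℤ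
∑-𝕀≡ (suc n) zero _ = cong (_+_ 1ℤ) (∑-zero n)
∑-𝕀≡ (suc n) (suc m) (s≤s m<n) = trans (ℤP.+-identityˡ _) (∑-𝕀≡ n m m<n)

∑-𝕀≡+suc : ∀ n a → ∣ a ∣ ℕ.≤ n → ∑ n (λ l → 𝕀 (does (a ℤ.≟ + suc l))) ≡ 𝕀 (does (+ 0 ℤ.<? a))
∑-𝕀≡+suc n (+ m) m≤n = ∑-𝕀≡suc n m m≤n
∑-𝕀≡+suc n -[1+ m ] _ = ∑-zero n

∑-𝕀≡-suc : ∀ n a → ∣ a ∣ ℕ.≤ n → ∑ n (λ l → 𝕀 (does (a ℤ.≟ -[1+ l ]))) ≡ 𝕀 (does (a ℤ.<? + 0))
∑-𝕀≡-suc n (+ m) _ = ∑-zero n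
∑-𝕀≡-suc n -[1+ m ] m<n = ∑-𝕀≡ n m m<n

𝕀-pos-+-𝕀-neg : ∀ a → a ≢ + 0 → 𝕀 (does (+ 0 ℤ.<? a)) + 𝕀 (does (a ℤ.<? + 0)) ≡ 1ℤ
𝕀-pos-+-𝕀-neg (+ zero) a≢0 = ⊥-elim (a≢0 refl)
𝕀-pos-+-𝕀-neg (+ suc m) _ = refl
𝕀-pos-+-𝕀-neg -[1+ m ] _ = refl

negCount-as-∑ : ∀ w → + negCount w ≡ ∑ (length w) (λ k → 𝕀 (does (entry w k ℤ.<? + 0)))
negCount-as-∑ [] = refl
negCount-as-∑ (a ∷ w) with a ℤ.<? + 0
... | yes _ = trans (ℤP.pos-+ 1 (negCount w)) (cong (_+_ 1ℤ) (negCount-as-∑ w))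
... | no _ = trans (negCount-as-∑ w) (sym (ℤP.+-identityˡ _))

-- dd and di are the two coordinates of d^±(k+1, l+1); `below l` and `below' k` are the
-- comparisons with the inserted value in π and in π⁻¹ respectively.
module GridSums (n : ℕ) (w : List ℤ) (∣w∣≡n : length w ≡ n) (below below' : ℕ → ℤ → Bool)
  (r r' : ℤ) (below-0 : ∀ l → 𝕀 (below l (+ 0)) ≡ r) (below'-0 : ∀ k → 𝕀 (below' k (+ 0)) ≡ r') where

  x y : ℕ → ℤ
  x = word₀ w
  y = word₀ (inverseB n w)

  open ProductSum n x y below below' public

  dd di : ℕ → ℕ → ℤ
  dd k l = descentGain (below l) x n k
  di k l = descentGain (below' k) y n l

  private
    D E : ℕ → ℤ
    D k = 𝕀 (k ℕ.<ᵇ n) * ⟦ x (suc k) < x k ⟧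
    E l = 𝕀 (l ℕ.<ᵇ n) * ⟦ y (suc l) < y l ⟧

    regroup : ∀ a g b c → a + g * (b - c) ≡ a + g * b - g * c
    regroup = solve-∀

    dd≡R-D : ∀ k l → dd k l ≡ R k l - D k
    dd≡R-D k l = regroup (𝕀 (below l (x k))) (𝕀 (k ℕ.<ᵇ n)) (𝕀 (not (below l (x (suc k))))) ⟦ x (suc k) < x k ⟧

    di≡R'-E : ∀ k l → di k l ≡ R' k l - E l
    di≡R'-E k l =
      regroup (𝕀 (below' k (y l))) (𝕀 (l ℕ.<ᵇ n)) (𝕀 (not (below' k (y (suc l))))) ⟦ y (suc l) < y l ⟧

    column-R : ∀ l → ∑ (suc n) (λ k → R k l) ≡ r + + n
    column-R l = trans (∑-𝕀-+-𝕀-not-next n (λ k → below l (x k))) (cong (_+ + n) (below-0 l))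

    row-R' : ∀ k → ∑ (suc n) (R' k) ≡ r' + + n
    row-R' k = trans (∑-𝕀-+-𝕀-not-next n (λ l → below' k (y l))) (cong (_+ + n) (below'-0 k))

    ∑D : ∑ (suc n) D ≡ + desB w
    ∑D = trans (∑-dropLast n (λ k → ⟦ x (suc k) < x k ⟧))
               (sym (subst (λ m → + desB w ≡ ∑ m (λ i → ⟦ x (suc i) < x i ⟧)) ∣w∣≡n (descents-as-∑ (+ 0) w)))

    ∑E : ∑ (suc n) E ≡ + idesB n w
    ∑E = trans (∑-dropLast n (λ k → ⟦ y (suc k) < y k ⟧))
               (sym (subst (λ m → + idesB n w ≡ ∑ m (λ i → ⟦ y (suc i) < y i ⟧)) (length-inverseB n w)
                           (descents-as-∑ (+ 0) (inverseB n w))))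

  ∑∑dd≡ : ∑∑ (suc n) dd ≡ + suc n * (r + + n) - + suc n * + desB w
  ∑∑dd≡ = trans (∑∑-cong (suc n) dd≡R-D)
         (trans (∑∑-sub-row (suc n) R D (r + + n) column-R) (cong (λ z → + suc n * (r + + n) - + suc n * z) ∑D))

  ∑∑di≡ : ∑∑ (suc n) di ≡ + suc n * (r' + + n - + idesB n w)
  ∑∑di≡ = trans (∑∑-cong (suc n) di≡R'-E)
         (trans (∑∑-sub-column (suc n) R' E (r' + + n) row-R') (cong (λ z → + suc n * (r' + + n - z)) ∑E))

  ∑∑dd*di≡ : ∑∑ (suc n) (λ k l → dd k l * di k l)
          ≡ ∑∑ (suc n) (λ k l → R k l * R' k l) - + desB w * (r' + + n) - + idesB n w * (r + + n) + + desB w * + idesB n w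
  ∑∑dd*di≡ = trans (∑∑-cong (suc n) (λ k l → cong₂ _*_ (dd≡R-D k l) (di≡R'-E k l)))
            (trans (∑∑-*-sub (suc n) R R' D E (r + + n) (r' + + n) column-R row-R')
                   (cong₂ (λ a b → ∑∑ (suc n) (λ k l → R k l * R' k l) - a * (r' + + n) - b * (r + + n) + a * b) ∑D ∑E))

module SignedPermFacts {n w} (π∈𝔅 : IsSignedPerm n w) where

  ∣w∣≡n : length w ≡ n
  ∣w∣≡n = length-signedPerm π∈𝔅

  private
    ∣entry∣≤n : ∀ k → k ℕ.< n → ∣ entry w k ∣ ℕ.≤ n
    ∣entry∣≤n k k<n with ∣entry∣-signedPerm π∈𝔅 k k<n
    ... | i , i<n , eq = subst (ℕ._≤ n) (sym eq) i<n

    entry≢0 : ∀ k → k ℕ.< n → entry w k ≢ + 0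
    entry≢0 k k<n eq with ∣entry∣-signedPerm π∈𝔅 k k<n
    ... | i , _ , ∣e∣≡ with () ← trans (sym (cong ∣_∣ eq)) ∣e∣≡

    ∑-negative : ∑ n (λ k → 𝕀 (does (entry w k ℤ.<? + 0))) ≡ + negCount w
    ∑-negative =
      sym (subst (λ m → + negCount w ≡ ∑ m (λ k → 𝕀 (does (entry w k ℤ.<? + 0)))) ∣w∣≡n (negCount-as-∑ w))

  x⇔y : ∀ σ k l → k ℕ.< n → l ℕ.< n →
    (word₀ w (suc k) ≡ σ ◃ suc l) ⇔ (word₀ (inverseB n w) (suc l) ≡ σ ◃ suc k)
  x⇔y σ k l k<n l<n = subst (λ z → (entry w k ≡ σ ◃ suc l) ⇔ (z ≡ σ ◃ suc k))
                            (sym (entry-inverseB n w l l<n)) (entry≡⇔invAt≡ π∈𝔅 σ k l k<n)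

  ∑∑-positive-hits : ∑∑ n (λ k l → 𝕀 (does (entry w k ℤ.≟ + suc l))) ≡ + n - + negCount w
  ∑∑-positive-hits = begin
    ∑ n (λ k → ∑ n (λ l → 𝕀 (does (entry w k ℤ.≟ + suc l))))
      ≡⟨ ∑-cong-< n (λ k k<n → ∑-𝕀≡+suc n (entry w k) (∣entry∣≤n k k<n)) ⟩
    ∑ n pos                                  ≡⟨ cancel (∑ n pos) (∑ n neg) ⟩
    ∑ n pos + ∑ n neg - ∑ n neg              ≡⟨ cong₂ _-_ (sym (∑-+ n pos neg)) ∑-negative ⟩
    ∑ n (λ k → pos k + neg k) - + negCount w
      ≡⟨ cong (_- + negCount w) (trans (∑-cong-< n (λ k k<n → 𝕀-pos-+-𝕀-neg (entry w k) (entry≢0 k k<n))) (∑-1 n)) ⟩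
    + n - + negCount w ∎
    where
    open ≡-Reasoning
    pos neg : ℕ → ℤ
    pos k = 𝕀 (does (+ 0 ℤ.<? entry w k))
    neg k = 𝕀 (does (entry w k ℤ.<? + 0))
    cancel : ∀ a b → a ≡ a + b - b
    cancel = solve-∀

  ∑∑-negative-hits : ∑∑ n (λ k l → 𝕀 (does (entry w k ℤ.≟ -[1+ l ]))) ≡ + negCount w
  ∑∑-negative-hits = trans (∑-cong-< n (λ k k<n → ∑-𝕀≡-suc n (entry w k) (∣entry∣≤n k k<n))) ∑-negative

module Counts⁺ {n w} (π∈𝔅 : IsSignedPerm n w) where
  open SignedPermFacts π∈𝔅
  open GridSums n w ∣w∣≡n (λ l → atLeast+ (suc l)) (λ k → atLeast+ (suc k)) 0ℤ 0ℤ (λ _ → refl) (λ _ → refl)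
  open ProductSum⁺ n x y refl refl (x⇔y Sign.+) using (∑∑-R*R'-value)
  open TypeCounts (suc n) (λ k l → dPlus n w (suc k) (suc l)) dd di
    (λ k l k≤n l≤n → cong₂ _,_ (desB-φ n w k l ∣w∣≡n (ℕP.≤-pred k≤n))
                               (idesB-φ n w k l ∣w∣≡n (ℕP.≤-pred k≤n) (ℕP.≤-pred l≤n)))
    (λ k l → descentGain-bit _ x n k (atLeast+-upward (suc l)))
    (λ k l → descentGain-bit _ y n l (atLeast+-upward (suc k)))

  private
    N d e m : ℤ
    N = + n
    d = + desB w
    e = + idesB n w
    m = + negCount w

    countPlus≡ : ∀ a b → + countPlus n w a b ≡ count a b
    countPlus≡ a b = count-gridPoints n (λ p → pairIs (dPlus n w (proj₁ p) (proj₂ p)) a b)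

    ∑∑dd*di-closed : ∑∑dd*di ≡ N * N + (N - m) - d * (0ℤ + N) - e * (0ℤ + N) + d * e
    ∑∑dd*di-closed = trans ∑∑dd*di≡ (cong (λ z → z - d * (0ℤ + N) - e * (0ℤ + N) + d * e)
                                         (trans ∑∑-R*R'-value (cong (_+_ (N * N)) ∑∑-positive-hits)))

  countPlus-00 : + countPlus n w 0ℤ 0ℤ ≡ (d + 1ℤ) * (e + 1ℤ) - m + N
  countPlus-00 = trans (countPlus≡ 0ℤ 0ℤ) (trans count-00
    (trans (cong₂ (λ a b → (1ℤ + N) * (1ℤ + N) - a - b + ∑∑dd*di) ∑∑dd≡ ∑∑di≡)
    (trans (cong (λ c → (1ℤ + N) * (1ℤ + N) - ((1ℤ + N) * (0ℤ + N) - (1ℤ + N) * d) - (1ℤ + N) * (0ℤ + N - e) + c)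
                 ∑∑dd*di-closed) (ring N d e m))))
    where
    ring : ∀ N d e m → (1ℤ + N) * (1ℤ + N) - ((1ℤ + N) * (0ℤ + N) - (1ℤ + N) * d) - (1ℤ + N) * (0ℤ + N - e)
                         + (N * N + (N - m) - d * (0ℤ + N) - e * (0ℤ + N) + d * e)
                       ≡ (d + 1ℤ) * (e + 1ℤ) - m + N
    ring = solve-∀

  countPlus-10 : + countPlus n w 1ℤ 0ℤ ≡ (e + 1ℤ) * (N - d) + m - N
  countPlus-10 = trans (countPlus≡ 1ℤ 0ℤ) (trans count-10 (trans (cong₂ _-_ ∑∑dd≡ ∑∑dd*di-closed) (ring N d e m)))
    where
    ring : ∀ N d e m → (1ℤ + N) * (0ℤ + N) - (1ℤ + N) * d - (N * N + (N - m) - d * (0ℤ + N) - e * (0ℤ + N) + d * e)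
                       ≡ (e + 1ℤ) * (N - d) + m - N
    ring = solve-∀

  countPlus-01 : + countPlus n w 0ℤ 1ℤ ≡ (d + 1ℤ) * (N - e) + m - N
  countPlus-01 = trans (countPlus≡ 0ℤ 1ℤ) (trans count-01 (trans (cong₂ _-_ ∑∑di≡ ∑∑dd*di-closed) (ring N d e m)))
    where
    ring : ∀ N d e m → (1ℤ + N) * (0ℤ + N - e) - (N * N + (N - m) - d * (0ℤ + N) - e * (0ℤ + N) + d * e)
                       ≡ (d + 1ℤ) * (N - e) + m - N
    ring = solve-∀

  countPlus-11 : + countPlus n w 1ℤ 1ℤ ≡ (N - d) * (N - e) - m + N
  countPlus-11 = trans (countPlus≡ 1ℤ 1ℤ) (trans count-11 (trans ∑∑dd*di-closed (ring N d e m)))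
    where
    ring : ∀ N d e m → N * N + (N - m) - d * (0ℤ + N) - e * (0ℤ + N) + d * e ≡ (N - d) * (N - e) - m + N
    ring = solve-∀

module Counts⁻ {n w} (π∈𝔅 : IsSignedPerm n w) where
  open SignedPermFacts π∈𝔅
  open GridSums n w ∣w∣≡n above- above- 1ℤ 1ℤ (λ _ → refl) (λ _ → refl)
  open ProductSum⁻ n x y refl refl (x⇔y Sign.-) using (∑∑-R*R'-value)
  open TypeCounts (suc n) (λ k l → dMinus n w (suc k) (suc l)) dd di
    (λ k l k≤n l≤n → cong₂ _,_ (desB-φ̄ n w k l ∣w∣≡n (ℕP.≤-pred k≤n))
                               (idesB-φ̄ n w k l ∣w∣≡n (ℕP.≤-pred k≤n) (ℕP.≤-pred l≤n)))
    (λ k l → descentGain-bit _ x n k (above--upward l))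
    (λ k l → descentGain-bit _ y n l (above--upward k))

  private
    N d e m : ℤ
    N = + n
    d = + desB w
    e = + idesB n w
    m = + negCount w

    countMinus≡ : ∀ a b → + countMinus n w a b ≡ count a b
    countMinus≡ a b = count-gridPoints n (λ p → pairIs (dMinus n w (proj₁ p) (proj₂ p)) a b)

    ∑∑dd*di-closed : ∑∑dd*di ≡ (1ℤ + N) * (1ℤ + N) + m - d * (1ℤ + N) - e * (1ℤ + N) + d * e
    ∑∑dd*di-closed = trans ∑∑dd*di≡ (cong (λ z → z - d * (1ℤ + N) - e * (1ℤ + N) + d * e)
                                         (trans ∑∑-R*R'-value (cong (_+_ ((1ℤ + N) * (1ℤ + N))) ∑∑-negative-hits)))

  countMinus-00 : + countMinus n w 0ℤ 0ℤ ≡ d * e + m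
  countMinus-00 = trans (countMinus≡ 0ℤ 0ℤ) (trans count-00
    (trans (cong₂ (λ a b → (1ℤ + N) * (1ℤ + N) - a - b + ∑∑dd*di) ∑∑dd≡ ∑∑di≡)
    (trans (cong (λ c → (1ℤ + N) * (1ℤ + N) - ((1ℤ + N) * (1ℤ + N) - (1ℤ + N) * d) - (1ℤ + N) * (1ℤ + N - e) + c)
                 ∑∑dd*di-closed) (ring N d e m))))
    where
    ring : ∀ N d e m → (1ℤ + N) * (1ℤ + N) - ((1ℤ + N) * (1ℤ + N) - (1ℤ + N) * d) - (1ℤ + N) * (1ℤ + N - e)
                         + ((1ℤ + N) * (1ℤ + N) + m - d * (1ℤ + N) - e * (1ℤ + N) + d * e)
                       ≡ d * e + m
    ring = solve-∀

  countMinus-10 : + countMinus n w 1ℤ 0ℤ ≡ e * (N - d + 1ℤ) - m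
  countMinus-10 = trans (countMinus≡ 1ℤ 0ℤ) (trans count-10 (trans (cong₂ _-_ ∑∑dd≡ ∑∑dd*di-closed) (ring N d e m)))
    where
    ring : ∀ N d e m → (1ℤ + N) * (1ℤ + N) - (1ℤ + N) * d - ((1ℤ + N) * (1ℤ + N) + m - d * (1ℤ + N) - e * (1ℤ + N) + d * e)
                       ≡ e * (N - d + 1ℤ) - m
    ring = solve-∀

  countMinus-01 : + countMinus n w 0ℤ 1ℤ ≡ d * (N - e + 1ℤ) - m
  countMinus-01 = trans (countMinus≡ 0ℤ 1ℤ) (trans count-01 (trans (cong₂ _-_ ∑∑di≡ ∑∑dd*di-closed) (ring N d e m)))
    where
    ring : ∀ N d e m → (1ℤ + N) * (1ℤ + N - e) - ((1ℤ + N) * (1ℤ + N) + m - d * (1ℤ + N) - e * (1ℤ + N) + d * e)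
                       ≡ d * (N - e + 1ℤ) - m
    ring = solve-∀

  countMinus-11 : + countMinus n w 1ℤ 1ℤ ≡ (N - d + 1ℤ) * (N - e + 1ℤ) + m
  countMinus-11 = trans (countMinus≡ 1ℤ 1ℤ) (trans count-11 (trans ∑∑dd*di-closed (ring N d e m)))
    where
    ring : ∀ N d e m → (1ℤ + N) * (1ℤ + N) + m - d * (1ℤ + N) - e * (1ℤ + N) + d * e ≡ (N - d + 1ℤ) * (N - e + 1ℤ) + m
    ring = solve-∀

theorem3p14 : (n : ℕ) (π : List ℤ) → IsSignedPerm n π →
  (+ countPlus n π 0ℤ 0ℤ ≡ (+ desB π + 1ℤ) * (+ idesB n π + 1ℤ) - + negCount π + + n)
  × (+ countPlus n π 1ℤ 0ℤ ≡ (+ idesB n π + 1ℤ) * (+ n - + desB π) + + negCount π - + n)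
  × (+ countPlus n π 0ℤ 1ℤ ≡ (+ desB π + 1ℤ) * (+ n - + idesB n π) + + negCount π - + n)
  × (+ countPlus n π 1ℤ 1ℤ ≡ (+ n - + desB π) * (+ n - + idesB n π) - + negCount π + + n)
  × (+ countMinus n π 0ℤ 0ℤ ≡ + desB π * + idesB n π + + negCount π)
  × (+ countMinus n π 1ℤ 0ℤ ≡ + idesB n π * (+ n - + desB π + 1ℤ) - + negCount π)
  × (+ countMinus n π 0ℤ 1ℤ ≡ + desB π * (+ n - + idesB n π + 1ℤ) - + negCount π)
  × (+ countMinus n π 1ℤ 1ℤ ≡ (+ n - + desB π + 1ℤ) * (+ n - + idesB n π + 1ℤ) + + negCount π)
theorem3p14 n π π∈𝔅 =
  countPlus-00 , countPlus-10 , countPlus-01 , countPlus-11 ,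
  countMinus-00 , countMinus-10 , countMinus-01 , countMinus-11
  where
  open Counts⁺ π∈𝔅
  open Counts⁻ π∈𝔅
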